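{- Let $r \geq 3$ and let $\mathcal{H}'$ be the $K_{r+1}^r$-decomposition of a friendship $r$-hypergraph on $n$ vertices. Then \[ |E(\mathcal{H}')| \leq \frac{2}{r(r+1)^2}\left\lfloor \frac{(r+1)(3r-4)}{6}\right\rfloor \binom{n}{r} + \frac{4}{r^2(r+1)^2}\left\lceil \frac{2(r+1)}{3} \right\rceil \binom{n}{r-1}. \]
   Context: For an $r$-uniform hypergraph $\mathcal{H}$ and a set of vertices $A$, a vertex $u \notin A$ is a friend of $A$ in $\mathcal{H}$ if for every $B \subseteq A$ with $|B| = r-1$, the set $B \cup \{u\}$ is a hyperedge of $\mathcal{H}$. An $r$-uniform hypergraph is a friendship $r$-hypergraph if every set of $r$ vertices has exactly one friend. The $K_{r+1}^r$-decomposition of $\mathcal{H}$ is the $(r+1)$-uniform hypergraph $\mathcal{H}'$ on $V(\mathcal{H})$ whose hyperedges are all $(r+1)$-subsets of $V(\mathcal{H})$ all of whose $r$-subsets are hyperedges of $\mathcal{H}$. -}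

module Defs where

open import Data.Bool using (Bool; true; false; _∧_; _∨_; not)
open import Data.Nat using (ℕ; zero; suc; _∸_; _≡ᵇ_)
open import Data.Fin using (Fin)
open import Data.Fin.Subset using (Subset; _∈_; _∉_; _⊆_; _∪_; ⁅_⁆; ∣_∣; inside; outside)
open import Data.Fin.Subset.Properties using (_⊆?_)
open import Data.List using (List; []; _∷_; _++_; map; filterᵇ; length)
open import Data.Vec using (_∷_; [])
open import Data.Product using (Σ; _×_)
open import Relation.Nullary using (does)
open import Relation.Binary.PropositionalEquality using (_≡_)

record Hypergraph (r n : ℕ) : Set where
  field
    edge    : Subset n → Bool
    uniform : ∀ S → edge S ≡ true → ∣ S ∣ ≡ r
open Hypergraph public

Friend : ∀ {r n} → Hypergraph r n → Fin n → Subset n → Set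
Friend {r} H u A = (u ∉ A) × (∀ B → B ⊆ A → ∣ B ∣ ≡ r ∸ 1 → edge H (B ∪ ⁅ u ⁆) ≡ true)

IsFriendship : ∀ {r n} → Hypergraph r n → Set
IsFriendship {r} {n} H =
  ∀ (A : Subset n) → ∣ A ∣ ≡ r →
    Σ (Fin n) (λ u → Friend H u A × (∀ v → Friend H v A → v ≡ u))

allSubsets : ∀ n → List (Subset n)
allSubsets zero    = [] ∷ []
allSubsets (suc n) = map (outside ∷_) (allSubsets n) ++ map (inside ∷_) (allSubsets n)

allᵇ : {A : Set} → (A → Bool) → List A → Bool
allᵇ p []       = true
allᵇ p (x ∷ xs) = p x ∧ allᵇ p xs

-- Hyperedge indicator of the K_{r+1}^r-decomposition H' of H: the
-- (r+1)-subsets S all of whose r-subsets T are hyperedges of H.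
decompEdge : ∀ {r n} → Hypergraph r n → Subset n → Bool
decompEdge {r} {n} H S =
  (∣ S ∣ ≡ᵇ suc r) ∧
  allᵇ (λ T → not (does (T ⊆? S) ∧ (∣ T ∣ ≡ᵇ r)) ∨ edge H T) (allSubsets n)

numEdges : ∀ {n} → (Subset n → Bool) → ℕ
numEdges {n} e = length (filterᵇ e (allSubsets n))

-- Call the hyperedges of H′ blocks. Every edge T of H lies in exactly one block, namely T together with
-- its friend, so an (r−1)-set Y whose degree in H is d(Y) lies in d(Y)/2 blocks. Double counting over the
-- ordered pairs (a, b) of distinct vertices of a block S then gives ∑_Y d(Y) = q·|H′| with q = (r+1)r, and
-- ∑_Y d(Y)² = ∑_S ∑_(a,b) d(S − a − b).
-- For a block S and a vertex y ∉ S, join a, b ∈ S when (S − a − b) ∪ {y} is not an edge. This graph has no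
-- isolated vertex (y would be a second friend of S − a) and no edge between two leaves (both ends would be
-- friends of the same r-set), so it has at least 2(r+1)/3 edges. Each such y thus contributes at most q − 2K,
-- K = ⌈2(r+1)/3⌉, to ∑_(a,b) d(S − a − b), while S itself contributes 2q; call the total bound G.
-- Cauchy–Schwarz now gives q²·|H′| ≤ G·C(n, r−1), and r·C(n, r) = (n−r+1)·C(n, r−1) turns this into the bound.

module Submission where

open import Data.Bool using (Bool; true; false; _∧_; _∨_; not; T)
open import Data.Bool.Properties
  using (∧-assoc; ∧-identityʳ; ∧-zeroʳ; ∨-identityʳ; ∨-zeroʳ; not-injective) renaming (_≟_ to _≟ᵇ_)
open import Data.Empty using (⊥; ⊥-elim)
open import Data.Fin using (Fin; zero; suc) renaming (_≟_ to _≟ᶠ_)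
import Data.Fin.Properties as FinP
open import Data.Fin.Subset using (Subset; _∈_; _∉_; _⊆_; _∪_; _─_; _-_; ⁅_⁆; ∣_∣)
open import Data.Fin.Subset.Properties using (_⊆?_; ⊆-trans; ∣p∣≤n; ∪-assoc; ∪-comm; p─x─y≡p─y─x)
open import Data.List using (List; []; _∷_; _++_; map; allFin; filterᵇ; length)
open import Data.List.Properties using (map-tabulate)
open import Data.Nat using (ℕ; zero; suc; _+_; _*_; _∸_; _^_; _≤_; _<_; z≤n; s≤s; s≤s⁻¹; _≡ᵇ_; _<?_; NonZero)
open import Data.Nat.Combinatorics using (_C_; nCk+nC[k+1]≡[n+1]C[k+1]; k>n⇒nCk≡0; nCk≡nC[n∸k]; nCn≡1)
open import Data.Nat.DivMod using (_/_; _%_; m<n*o⇒m/o<n; m≡m%n+[m/n]*n; m%n<n; m/n*n≤m; /-monoˡ-≤; m*n/n≡m)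
open import Data.Nat.Properties
open import Data.Nat.Tactic.RingSolver using (solve-∀)
open import Data.Product using (Σ; _×_; _,_; proj₁; proj₂)
open import Data.Sum using (_⊎_; inj₁; inj₂)
import Data.Vec as Vec
open import Data.Vec using ([]; _∷_; lookup)
open import Data.Vec.Properties using ([]=⇒lookup; lookup⇒[]=; lookup-zipWith; tabulate∘lookup; tabulate-cong; ≡-dec)
open import Function using (id)
open import Relation.Binary.PropositionalEquality
open import Relation.Nullary using (¬_; Dec; yes; no; does)

open import Defs

private variable
  A B : Set
  n : ℕ

-- Sums over vertices and over subsets

𝟙 : Bool → ℕ
𝟙 true  = 1
𝟙 false = 0

𝟙≤1 : ∀ b → 𝟙 b ≤ 1
𝟙≤1 true  = s≤s z≤n
𝟙≤1 false = z≤n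

𝟙-∧ : ∀ a b → 𝟙 (a ∧ b) ≡ 𝟙 a * 𝟙 b
𝟙-∧ true  b = sym (+-identityʳ (𝟙 b))
𝟙-∧ false b = refl

∑ : List A → (A → ℕ) → ℕ
∑ []       f = 0
∑ (x ∷ xs) f = f x + ∑ xs f

∑-cong : ∀ (xs : List A) {f g : A → ℕ} → (∀ x → f x ≡ g x) → ∑ xs f ≡ ∑ xs g
∑-cong []       h = refl
∑-cong (x ∷ xs) h = cong₂ _+_ (h x) (∑-cong xs h)

∑-mono-≤ : ∀ (xs : List A) {f g : A → ℕ} → (∀ x → f x ≤ g x) → ∑ xs f ≤ ∑ xs g
∑-mono-≤ []       h = z≤n
∑-mono-≤ (x ∷ xs) h = +-mono-≤ (h x) (∑-mono-≤ xs h)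

∑-zero : ∀ (xs : List A) {f : A → ℕ} → (∀ x → f x ≡ 0) → ∑ xs f ≡ 0
∑-zero []       h = refl
∑-zero (x ∷ xs) h rewrite h x = ∑-zero xs h

∑-distrib-+ : ∀ (xs : List A) (f g : A → ℕ) → ∑ xs (λ x → f x + g x) ≡ ∑ xs f + ∑ xs g
∑-distrib-+ []       f g = refl
∑-distrib-+ (x ∷ xs) f g rewrite ∑-distrib-+ xs f g = interchange (f x) (g x) (∑ xs f) (∑ xs g)
  where
  interchange : ∀ a b c d → a + b + (c + d) ≡ a + c + (b + d)
  interchange = solve-∀

∑-*ˡ : ∀ (xs : List A) c (f : A → ℕ) → ∑ xs (λ x → c * f x) ≡ c * ∑ xs f
∑-*ˡ []       c f = sym (*-zeroʳ c)
∑-*ˡ (x ∷ xs) c f rewrite ∑-*ˡ xs c f = sym (*-distribˡ-+ c (f x) (∑ xs f))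

∑-++ : ∀ (xs ys : List A) (f : A → ℕ) → ∑ (xs ++ ys) f ≡ ∑ xs f + ∑ ys f
∑-++ []       ys f = refl
∑-++ (x ∷ xs) ys f rewrite ∑-++ xs ys f = sym (+-assoc (f x) _ _)

∑-map : ∀ (h : B → A) (xs : List B) (f : A → ℕ) → ∑ (map h xs) f ≡ ∑ xs (λ x → f (h x))
∑-map h []       f = refl
∑-map h (x ∷ xs) f = cong (f (h x) +_) (∑-map h xs f)

∑-comm : ∀ (xs : List A) (ys : List B) (F : A → B → ℕ) →
  ∑ xs (λ x → ∑ ys (F x)) ≡ ∑ ys (λ y → ∑ xs (λ x → F x y))
∑-comm []       ys F = sym (∑-zero ys (λ _ → refl))
∑-comm (x ∷ xs) ys F rewrite ∑-comm xs ys F = sym (∑-distrib-+ ys (F x) (λ y → ∑ xs (λ x → F x y)))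

-- Opaque, so that unification sees the summand instead of the unfolded sum.
opaque
  ∑ᵥ : (Fin n → ℕ) → ℕ
  ∑ᵥ {n} = ∑ (allFin n)

  ∑ₛ : (Subset n → ℕ) → ℕ
  ∑ₛ {n} = ∑ (allSubsets n)

  ∑ᵥ-Fin0 : (f : Fin 0 → ℕ) → ∑ᵥ f ≡ 0
  ∑ᵥ-Fin0 f = refl

  ∑ₛ-Subset0 : (f : Subset 0 → ℕ) → ∑ₛ f ≡ f []
  ∑ₛ-Subset0 f = +-identityʳ (f [])

  numEdges≡∑ : (e : Subset n → Bool) → numEdges e ≡ ∑ₛ (λ p → 𝟙 (e p))
  numEdges≡∑ {n} e = go (allSubsets n)
    where
    go : ∀ ps → length (filterᵇ e ps) ≡ ∑ ps (λ p → 𝟙 (e p))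
    go []       = refl
    go (p ∷ ps) with e p
    ... | true  = cong suc (go ps)
    ... | false = go ps

  ∑ᵥ-suc : (f : Fin (suc n) → ℕ) → ∑ᵥ f ≡ f zero + ∑ᵥ (λ i → f (suc i))
  ∑ᵥ-suc {n} f = cong (f zero +_) (trans (cong (λ xs → ∑ xs f) (sym (map-tabulate id suc))) (∑-map suc (allFin n) f))

  ∑ᵥ-1≡n : ∀ n → ∑ᵥ {n} (λ _ → 1) ≡ n
  ∑ᵥ-1≡n zero    = refl
  ∑ᵥ-1≡n (suc n) = trans (∑ᵥ-suc {n} (λ _ → 1)) (cong suc (∑ᵥ-1≡n n))

  ∑ₛ-suc : (f : Subset (suc n) → ℕ) → ∑ₛ f ≡ ∑ₛ (λ X → f (false ∷ X)) + ∑ₛ (λ X → f (true ∷ X))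
  ∑ₛ-suc {n} f rewrite ∑-++ (map (false ∷_) (allSubsets n)) (map (true ∷_) (allSubsets n)) f
    | ∑-map (false ∷_) (allSubsets n) f | ∑-map (true ∷_) (allSubsets n) f = refl

  ∑ᵥ-cong : {f g : Fin n → ℕ} → (∀ i → f i ≡ g i) → ∑ᵥ f ≡ ∑ᵥ g
  ∑ᵥ-cong {n} = ∑-cong (allFin n)

  ∑ₛ-cong : {f g : Subset n → ℕ} → (∀ X → f X ≡ g X) → ∑ₛ f ≡ ∑ₛ g
  ∑ₛ-cong {n} = ∑-cong (allSubsets n)

  ∑ᵥ-mono-≤ : {f g : Fin n → ℕ} → (∀ i → f i ≤ g i) → ∑ᵥ f ≤ ∑ᵥ g
  ∑ᵥ-mono-≤ {n} = ∑-mono-≤ (allFin n)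

  ∑ₛ-mono-≤ : {f g : Subset n → ℕ} → (∀ X → f X ≤ g X) → ∑ₛ f ≤ ∑ₛ g
  ∑ₛ-mono-≤ {n} = ∑-mono-≤ (allSubsets n)

  ∑ᵥ-zero : {f : Fin n → ℕ} → (∀ i → f i ≡ 0) → ∑ᵥ f ≡ 0
  ∑ᵥ-zero {n} = ∑-zero (allFin n)

  ∑ₛ-zero : {f : Subset n → ℕ} → (∀ X → f X ≡ 0) → ∑ₛ f ≡ 0
  ∑ₛ-zero {n} = ∑-zero (allSubsets n)

  ∑ᵥ-distrib-+ : (f g : Fin n → ℕ) → ∑ᵥ (λ i → f i + g i) ≡ ∑ᵥ f + ∑ᵥ g
  ∑ᵥ-distrib-+ {n} = ∑-distrib-+ (allFin n)

  ∑ₛ-distrib-+ : (f g : Subset n → ℕ) → ∑ₛ (λ X → f X + g X) ≡ ∑ₛ f + ∑ₛ g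
  ∑ₛ-distrib-+ {n} = ∑-distrib-+ (allSubsets n)

  ∑ᵥ-*ˡ : ∀ c (f : Fin n → ℕ) → ∑ᵥ (λ i → c * f i) ≡ c * ∑ᵥ f
  ∑ᵥ-*ˡ {n} = ∑-*ˡ (allFin n)

  ∑ᵥ-*ʳ : ∀ c (f : Fin n → ℕ) → ∑ᵥ (λ i → f i * c) ≡ ∑ᵥ f * c
  ∑ᵥ-*ʳ {n} c f = trans (∑ᵥ-cong (λ i → *-comm (f i) c)) (trans (∑ᵥ-*ˡ c f) (*-comm c _))

  ∑ₛ-*ˡ : ∀ c (f : Subset n → ℕ) → ∑ₛ (λ X → c * f X) ≡ c * ∑ₛ f
  ∑ₛ-*ˡ {n} = ∑-*ˡ (allSubsets n)

  ∑ₛ-*ʳ : ∀ c (f : Subset n → ℕ) → ∑ₛ (λ p → f p * c) ≡ ∑ₛ f * c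
  ∑ₛ-*ʳ {n} c f = trans (∑ₛ-cong (λ p → *-comm (f p) c)) (trans (∑ₛ-*ˡ c f) (*-comm c _))

  ∑ᵥ-comm : (F : Fin n → Fin n → ℕ) → ∑ᵥ (λ i → ∑ᵥ (F i)) ≡ ∑ᵥ (λ j → ∑ᵥ (λ i → F i j))
  ∑ᵥ-comm {n} = ∑-comm (allFin n) (allFin n)

  ∑ₛ-comm : (F : Subset n → Subset n → ℕ) → ∑ₛ (λ X → ∑ₛ (F X)) ≡ ∑ₛ (λ Y → ∑ₛ (λ X → F X Y))
  ∑ₛ-comm {n} = ∑-comm (allSubsets n) (allSubsets n)

  ∑ᵥ∑ₛ-comm : (F : Fin n → Subset n → ℕ) → ∑ᵥ (λ i → ∑ₛ (F i)) ≡ ∑ₛ (λ X → ∑ᵥ (λ i → F i X))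
  ∑ᵥ∑ₛ-comm {n} = ∑-comm (allFin n) (allSubsets n)

  ∑ᵥ-≤ : ∀ (f : Fin n → ℕ) i → f i ≤ ∑ᵥ f
  ∑ᵥ-≤ {suc n} f zero    rewrite ∑ᵥ-suc f = m≤m+n _ _
  ∑ᵥ-≤ {suc n} f (suc i) rewrite ∑ᵥ-suc f = ≤-trans (∑ᵥ-≤ (λ j → f (suc j)) i) (m≤n+m _ _)

  ∑ᵥ-positive : ∀ (f : Fin n → ℕ) → 0 < ∑ᵥ f → Σ (Fin n) (λ i → 0 < f i)
  ∑ᵥ-positive {suc n} f pos rewrite ∑ᵥ-suc f with f zero in eq
  ... | suc _ = zero , subst (0 <_) (sym eq) (s≤s z≤n)
  ... | zero with ∑ᵥ-positive (λ i → f (suc i)) pos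
  ...   | i , fi>0 = suc i , fi>0

  ∑ᵥ-single : ∀ (f : Fin n → ℕ) i → (∀ j → j ≢ i → f j ≡ 0) → ∑ᵥ f ≡ f i
  ∑ᵥ-single {suc n} f zero h rewrite ∑ᵥ-suc f =
    trans (cong (f zero +_) (∑ᵥ-zero (λ j → h (suc j) λ ()))) (+-identityʳ _)
  ∑ᵥ-single {suc n} f (suc i) h rewrite ∑ᵥ-suc f | h zero (λ ()) =
    ∑ᵥ-single (λ j → f (suc j)) i (λ j j≢i → h (suc j) (λ eq → j≢i (FinP.suc-injective eq)))

  ∑ₛ-single : ∀ (f : Subset n → ℕ) X → (∀ Y → Y ≢ X → f Y ≡ 0) → ∑ₛ f ≡ f X
  ∑ₛ-single {zero}  f [] h = +-identityʳ _
  ∑ₛ-single {suc n} f (false ∷ X) h rewrite ∑ₛ-suc f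
    | ∑ₛ-zero {f = λ Y → f (true ∷ Y)} (λ Y → h (true ∷ Y) λ ())
    = trans (+-identityʳ _) (∑ₛ-single (λ Y → f (false ∷ Y)) X (λ Y Y≢X → h (false ∷ Y) (λ eq → Y≢X (cong Vec.tail eq))))
  ∑ₛ-single {suc n} f (true ∷ X) h rewrite ∑ₛ-suc f
    | ∑ₛ-zero {f = λ Y → f (false ∷ Y)} (λ Y → h (false ∷ Y) λ ())
    = ∑ₛ-single (λ Y → f (true ∷ Y)) X (λ Y Y≢X → h (true ∷ Y) (λ eq → Y≢X (cong Vec.tail eq)))

-- Subsets of Fin n via lookup

true≢false : true ≢ false
true≢false ()

∧-true⁻ : ∀ {a b} → a ∧ b ≡ true → a ≡ true × b ≡ true
∧-true⁻ {true} {true} _ = refl , refl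

∧-true⁺ : ∀ {a b} → a ≡ true → b ≡ true → a ∧ b ≡ true
∧-true⁺ refl refl = refl

Bool-ext : ∀ {a b} → (a ≡ true → b ≡ true) → (b ≡ true → a ≡ true) → a ≡ b
Bool-ext {true}  {true}  _ _ = refl
Bool-ext {true}  {false} f _ = sym (f refl)
Bool-ext {false} {true}  _ g = g refl
Bool-ext {false} {false} _ _ = refl

lookup-⊥ : ∀ (i : Fin n) → lookup (Data.Fin.Subset.⊥ {n}) i ≡ false
lookup-⊥ zero    = refl
lookup-⊥ (suc i) = lookup-⊥ i

opaque
  _==_ : Fin n → Fin n → Bool
  i == j = does (i ≟ᶠ j)

  ==-refl : ∀ (i : Fin n) → (i == i) ≡ true
  ==-refl i with i ≟ᶠ i
  ... | yes _   = refl
  ... | no  i≢i = ⊥-elim (i≢i refl)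

  ≢⇒==-false : ∀ {i j : Fin n} → i ≢ j → (i == j) ≡ false
  ≢⇒==-false {i = i} {j} i≢j with i ≟ᶠ j
  ... | yes i≡j = ⊥-elim (i≢j i≡j)
  ... | no  _   = refl

  ==⇒≡ : ∀ {i j : Fin n} → (i == j) ≡ true → i ≡ j
  ==⇒≡ {i = i} {j} eq with i ≟ᶠ j
  ... | yes i≡j = i≡j

  ==-sym : ∀ (i j : Fin n) → (i == j) ≡ (j == i)
  ==-sym i j = Bool-ext (λ eq → subst (λ k → (k == i) ≡ true) (==⇒≡ {i = i} eq) (==-refl i))
                        (λ eq → subst (λ k → (k == j) ≡ true) (==⇒≡ {i = j} eq) (==-refl j))

  lookup-⁅⁆ : ∀ (x i : Fin n) → lookup ⁅ x ⁆ i ≡ (i == x)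
  lookup-⁅⁆ zero    zero    = refl
  lookup-⁅⁆ zero    (suc i) = lookup-⊥ i
  lookup-⁅⁆ (suc x) zero    = refl
  lookup-⁅⁆ (suc x) (suc i) with lookup-⁅⁆ x i
  ... | eq with i ≟ᶠ x
  ...   | yes refl = eq
  ...   | no  _    = eq

lookup-∪ : ∀ (p q : Subset n) i → lookup (p ∪ q) i ≡ (lookup p i ∨ lookup q i)
lookup-∪ p q i = lookup-zipWith _∨_ i p q

lookup-─ : ∀ (p q : Subset n) i → lookup (p ─ q) i ≡ (lookup p i ∧ not (lookup q i))
lookup-─ (a ∷ p) (true  ∷ q) zero    = sym (∧-zeroʳ a)
lookup-─ (a ∷ p) (false ∷ q) zero    = sym (∧-identityʳ a)
lookup-─ (a ∷ p) (b     ∷ q) (suc i) = lookup-─ p q i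

lookup[p-x] : ∀ (p : Subset n) x i → lookup (p - x) i ≡ (lookup p i ∧ not (i == x))
lookup[p-x] p x i = trans (lookup-─ p ⁅ x ⁆ i) (cong (λ b → lookup p i ∧ not b) (lookup-⁅⁆ x i))

lookup-∪⁅⁆ : ∀ (p : Subset n) x i → lookup (p ∪ ⁅ x ⁆) i ≡ (lookup p i ∨ (i == x))
lookup-∪⁅⁆ p x i = trans (lookup-∪ p ⁅ x ⁆ i) (cong (lookup p i ∨_) (lookup-⁅⁆ x i))

lookup-injective : ∀ {p q : Subset n} → (∀ i → lookup p i ≡ lookup q i) → p ≡ q
lookup-injective {p = p} {q} h = trans (sym (tabulate∘lookup p)) (trans (tabulate-cong h) (tabulate∘lookup q))

lookup⇒∈ : ∀ {p : Subset n} {i} → lookup p i ≡ true → i ∈ p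
lookup⇒∈ {p = p} {i} = lookup⇒[]= i p

∉⇒lookup : ∀ {p : Subset n} {i} → i ∉ p → lookup p i ≡ false
∉⇒lookup {p = p} {i} i∉p with lookup p i in eq
... | true  = ⊥-elim (i∉p (lookup⇒∈ eq))
... | false = refl

lookup⇒∉ : ∀ {p : Subset n} {i} → lookup p i ≡ false → i ∉ p
lookup⇒∉ eq i∈p = true≢false (trans (sym ([]=⇒lookup i∈p)) eq)

⊆⇒lookup : ∀ {p q : Subset n} → p ⊆ q → ∀ i → lookup p i ≡ true → lookup q i ≡ true
⊆⇒lookup p⊆q i eq = []=⇒lookup (p⊆q (lookup⇒∈ eq))

lookup⇒⊆ : ∀ {p q : Subset n} → (∀ i → lookup p i ≡ true → lookup q i ≡ true) → p ⊆ q
lookup⇒⊆ h {i} i∈p = lookup⇒∈ (h i ([]=⇒lookup i∈p))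

⊆⇒lookup-false : ∀ {p q : Subset n} {i} → p ⊆ q → lookup q i ≡ false → lookup p i ≡ false
⊆⇒lookup-false {p = p} {i = i} p⊆q eq with lookup p i in eq′
... | false = refl
... | true  = ⊥-elim (true≢false (trans (sym (⊆⇒lookup p⊆q i eq′)) eq))

lookup[p-x]x≡false : ∀ (p : Subset n) x → lookup (p - x) x ≡ false
lookup[p-x]x≡false p x = trans (lookup[p-x] p x x) (trans (cong (λ b → lookup p x ∧ not b) (==-refl x)) (∧-zeroʳ _))

lookup[p-y]x≡true : ∀ (p : Subset n) {x y} → lookup p x ≡ true → x ≢ y → lookup (p - y) x ≡ true
lookup[p-y]x≡true p {x} {y} px x≢y = trans (lookup[p-x] p y x) (∧-true⁺ px (cong not (≢⇒==-false x≢y)))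

lookup[p-x]y⇒y≢x : ∀ (p : Subset n) {x y} → lookup (p - x) y ≡ true → y ≢ x
lookup[p-x]y⇒y≢x p {x} eq refl = true≢false (trans (sym eq) (lookup[p-x]x≡false p x))

lookup-true-false⇒≢ : ∀ (p : Subset n) {x y} → lookup p x ≡ true → lookup p y ≡ false → x ≢ y
lookup-true-false⇒≢ p px py refl = true≢false (trans (sym px) py)

p-x⊆p : ∀ (p : Subset n) x → p - x ⊆ p
p-x⊆p p x = lookup⇒⊆ λ i eq → proj₁ (∧-true⁻ (trans (sym (lookup[p-x] p x i)) eq))

p⊆p∪⁅x⁆ : ∀ (p : Subset n) x → p ⊆ p ∪ ⁅ x ⁆
p⊆p∪⁅x⁆ p x = lookup⇒⊆ λ i eq → trans (lookup-∪⁅⁆ p x i) (cong (_∨ (i == x)) eq)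

p∪⁅x⁆⊆q : ∀ {p q : Subset n} {x} → p ⊆ q → lookup q x ≡ true → p ∪ ⁅ x ⁆ ⊆ q
p∪⁅x⁆⊆q {p = p} {q} {x} p⊆q qx = lookup⇒⊆ λ i eq → cases i (trans (sym (lookup-∪⁅⁆ p x i)) eq)
  where
  cases : ∀ i → (lookup p i ∨ (i == x)) ≡ true → lookup q i ≡ true
  cases i eq with lookup p i in pi | i == x in i=x
  ... | true  | _     = ⊆⇒lookup p⊆q i pi
  ... | false | true  = subst (λ j → lookup q j ≡ true) (sym (==⇒≡ i=x)) qx
  ... | false | false = ⊥-elim (true≢false (sym eq))

p∪⁅x⁆-x≡p : ∀ (p : Subset n) x → lookup p x ≡ false → (p ∪ ⁅ x ⁆) - x ≡ p
p∪⁅x⁆-x≡p p x px = lookup-injective λ i →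
  trans (lookup[p-x] (p ∪ ⁅ x ⁆) x i) (trans (cong (_∧ not (i == x)) (lookup-∪⁅⁆ p x i)) (pointwise i))
  where
  pointwise : ∀ i → ((lookup p i ∨ (i == x)) ∧ not (i == x)) ≡ lookup p i
  pointwise i with i == x in i=x
  ... | true  = trans (∧-zeroʳ _) (sym (subst (λ j → lookup p j ≡ false) (sym (==⇒≡ i=x)) px))
  ... | false = trans (∧-identityʳ _) (∨-identityʳ _)

[p∪⁅x⁆]-y≡[p-y]∪⁅x⁆ : ∀ (p : Subset n) {x y} → x ≢ y → (p ∪ ⁅ x ⁆) - y ≡ (p - y) ∪ ⁅ x ⁆
[p∪⁅x⁆]-y≡[p-y]∪⁅x⁆ p {x} {y} x≢y = lookup-injective λ i →
  trans (lookup[p-x] (p ∪ ⁅ x ⁆) y i) (trans (cong (_∧ not (i == y)) (lookup-∪⁅⁆ p x i))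
  (trans (pointwise i) (sym (trans (lookup-∪⁅⁆ (p - y) x i) (cong (_∨ (i == x)) (lookup[p-x] p y i))))))
  where
  pointwise : ∀ i → ((lookup p i ∨ (i == x)) ∧ not (i == y)) ≡ ((lookup p i ∧ not (i == y)) ∨ (i == x))
  pointwise i with i == x in i=x
  ... | true  rewrite ≢⇒==-false {i = i} (λ i≡y → x≢y (trans (sym (==⇒≡ i=x)) i≡y)) =
    trans (∧-identityʳ _) (trans (∨-zeroʳ (lookup p i)) (sym (∨-zeroʳ _)))
  ... | false = trans (cong (_∧ not (i == y)) (∨-identityʳ (lookup p i))) (sym (∨-identityʳ _))

q⊆p∪⁅x⁆⇒q-x⊆p : ∀ {p q : Subset n} {x} → q ⊆ p ∪ ⁅ x ⁆ → q - x ⊆ p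
q⊆p∪⁅x⁆⇒q-x⊆p {p = p} {q} {x} q⊆p∪x = lookup⇒⊆ λ i qxi → pointwise i (∧-true⁻ (trans (sym (lookup[p-x] q x i)) qxi))
  where
  pointwise : ∀ i → lookup q i ≡ true × not (i == x) ≡ true → lookup p i ≡ true
  pointwise i (qi , i≠x) = trans (sym (∨-identityʳ (lookup p i)))
    (trans (cong (lookup p i ∨_) (sym (not-injective i≠x))) (trans (sym (lookup-∪⁅⁆ p x i)) (⊆⇒lookup q⊆p∪x i qi)))

x∉q⇒q⊆q-x : ∀ {q : Subset n} {x} → lookup q x ≡ false → q ⊆ q - x
x∉q⇒q⊆q-x {q = q} qx = lookup⇒⊆ λ i qi → lookup[p-y]x≡true q qi (lookup-true-false⇒≢ q qi qx)

p∪⁅x⁆∪⁅y⁆≡p∪⁅y⁆∪⁅x⁆ : ∀ (p : Subset n) x y → (p ∪ ⁅ x ⁆) ∪ ⁅ y ⁆ ≡ (p ∪ ⁅ y ⁆) ∪ ⁅ x ⁆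
p∪⁅x⁆∪⁅y⁆≡p∪⁅y⁆∪⁅x⁆ p x y =
  trans (∪-assoc p ⁅ x ⁆ ⁅ y ⁆) (trans (cong (p ∪_) (∪-comm ⁅ x ⁆ ⁅ y ⁆)) (sym (∪-assoc p ⁅ y ⁆ ⁅ x ⁆)))

∣p∣≡∑ : ∀ (p : Subset n) → ∣ p ∣ ≡ ∑ᵥ (λ i → 𝟙 (lookup p i))
∣p∣≡∑ {zero}  []          = sym (∑ᵥ-Fin0 _)
∣p∣≡∑ {suc n} (true ∷ p)  = trans (cong suc (∣p∣≡∑ p)) (sym (∑ᵥ-suc (λ i → 𝟙 (lookup (true ∷ p) i))))
∣p∣≡∑ {suc n} (false ∷ p) = trans (∣p∣≡∑ p) (sym (∑ᵥ-suc (λ i → 𝟙 (lookup (false ∷ p) i))))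

∑ᵥ[∉p]≡n∸∣p∣ : ∀ (p : Subset n) → ∑ᵥ (λ i → 𝟙 (not (lookup p i))) ≡ n ∸ ∣ p ∣
∑ᵥ[∉p]≡n∸∣p∣ {n} p = trans (sym (m+n∸n≡m _ ∣ p ∣)) (cong (_∸ ∣ p ∣) (begin
  ∑ᵥ (λ i → 𝟙 (not (lookup p i))) + ∣ p ∣                     ≡⟨ cong (∑ᵥ (λ i → 𝟙 (not (lookup p i))) +_) (∣p∣≡∑ p) ⟩
  ∑ᵥ (λ i → 𝟙 (not (lookup p i))) + ∑ᵥ (λ i → 𝟙 (lookup p i)) ≡⟨ sym (∑ᵥ-distrib-+ _ _) ⟩
  ∑ᵥ (λ i → 𝟙 (not (lookup p i)) + 𝟙 (lookup p i))            ≡⟨ ∑ᵥ-cong (λ i → one (lookup p i)) ⟩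
  ∑ᵥ (λ _ → 1)                                                ≡⟨ ∑ᵥ-1≡n n ⟩
  n                                                           ∎))
  where
  open ≡-Reasoning
  one : ∀ b → 𝟙 (not b) + 𝟙 b ≡ 1
  one true  = refl
  one false = refl

∑ᵥ-== : ∀ (x : Fin n) (f : Fin n → ℕ) → ∑ᵥ (λ i → 𝟙 (i == x) * f i) ≡ f x
∑ᵥ-== x f = trans (∑ᵥ-single _ x λ j j≢x → cong (λ b → 𝟙 b * f j) (≢⇒==-false j≢x))
                  (trans (cong (λ b → 𝟙 b * f x) (==-refl x)) (+-identityʳ _))

∑ᵥ-𝟙== : ∀ (x : Fin n) → ∑ᵥ (λ i → 𝟙 (i == x)) ≡ 1
∑ᵥ-𝟙== x = trans (∑ᵥ-cong λ i → sym (*-identityʳ _)) (∑ᵥ-== x (λ _ → 1))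

∣∣-split : ∀ (p q : Subset n) x → (∀ i → 𝟙 (lookup p i) ≡ 𝟙 (lookup q i) + 𝟙 (i == x)) →
  ∣ p ∣ ≡ suc ∣ q ∣
∣∣-split p q x h = begin
  ∣ p ∣                                                   ≡⟨ ∣p∣≡∑ p ⟩
  ∑ᵥ (λ i → 𝟙 (lookup p i))                               ≡⟨ ∑ᵥ-cong h ⟩
  ∑ᵥ (λ i → 𝟙 (lookup q i) + 𝟙 (i == x))                  ≡⟨ ∑ᵥ-distrib-+ _ _ ⟩
  ∑ᵥ (λ i → 𝟙 (lookup q i)) + ∑ᵥ (λ i → 𝟙 (i == x))       ≡⟨ cong₂ _+_ (sym (∣p∣≡∑ q)) (∑ᵥ-𝟙== x) ⟩
  ∣ q ∣ + 1                                               ≡⟨ +-comm _ 1 ⟩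
  suc ∣ q ∣                                               ∎
  where open ≡-Reasoning

∣p∣≡1+∣p-x∣ : ∀ (p : Subset n) x → lookup p x ≡ true → ∣ p ∣ ≡ suc ∣ p - x ∣
∣p∣≡1+∣p-x∣ p x px = ∣∣-split p (p - x) x pointwise
  where
  pointwise : ∀ i → 𝟙 (lookup p i) ≡ 𝟙 (lookup (p - x) i) + 𝟙 (i == x)
  pointwise i rewrite lookup[p-x] p x i with i == x in i=x | lookup p i in pi
  ... | true  | true  = refl
  ... | true  | false = ⊥-elim (true≢false (trans (sym px) (subst (λ j → lookup p j ≡ false) (==⇒≡ i=x) pi)))
  ... | false | true  = refl
  ... | false | false = refl

∣p∪⁅x⁆∣≡1+∣p∣ : ∀ (p : Subset n) x → lookup p x ≡ false → ∣ p ∪ ⁅ x ⁆ ∣ ≡ suc ∣ p ∣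
∣p∪⁅x⁆∣≡1+∣p∣ p x px = ∣∣-split (p ∪ ⁅ x ⁆) p x pointwise
  where
  pointwise : ∀ i → 𝟙 (lookup (p ∪ ⁅ x ⁆) i) ≡ 𝟙 (lookup p i) + 𝟙 (i == x)
  pointwise i rewrite lookup-∪⁅⁆ p x i with i == x in i=x | lookup p i in pi
  ... | true  | true  = ⊥-elim (true≢false (trans (sym pi) (subst (λ j → lookup p j ≡ false) (sym (==⇒≡ i=x)) px)))
  ... | true  | false = refl
  ... | false | true  = refl
  ... | false | false = refl

∣_∖_∣ : Subset n → Subset n → ℕ
∣ q ∖ p ∣ = ∑ᵥ (λ i → 𝟙 (lookup q i ∧ not (lookup p i)))

⊆⇒∣q∣≡∣p∣+∣q∖p∣ : ∀ {p q : Subset n} → p ⊆ q → ∣ q ∣ ≡ ∣ p ∣ + ∣ q ∖ p ∣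
⊆⇒∣q∣≡∣p∣+∣q∖p∣ {p = p} {q} p⊆q = begin
  ∣ q ∣                                                         ≡⟨ ∣p∣≡∑ q ⟩
  ∑ᵥ (λ i → 𝟙 (lookup q i))                                     ≡⟨ ∑ᵥ-cong pointwise ⟩
  ∑ᵥ (λ i → 𝟙 (lookup p i) + 𝟙 (lookup q i ∧ not (lookup p i)))  ≡⟨ ∑ᵥ-distrib-+ _ _ ⟩
  ∑ᵥ (λ i → 𝟙 (lookup p i)) + ∣ q ∖ p ∣                         ≡⟨ cong (_+ ∣ q ∖ p ∣) (sym (∣p∣≡∑ p)) ⟩
  ∣ p ∣ + ∣ q ∖ p ∣                                             ∎
  where
  open ≡-Reasoning
  pointwise : ∀ i → 𝟙 (lookup q i) ≡ 𝟙 (lookup p i) + 𝟙 (lookup q i ∧ not (lookup p i))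
  pointwise i with lookup p i in pi
  ... | true rewrite ⊆⇒lookup p⊆q i pi = refl
  ... | false with lookup q i
  ...   | true  = refl
  ...   | false = refl

𝟙-positive : ∀ {b} → 0 < 𝟙 b → b ≡ true
𝟙-positive {true} _ = refl

⊆∧∣q∣≤∣p∣⇒≡ : ∀ {p q : Subset n} → p ⊆ q → ∣ q ∣ ≤ ∣ p ∣ → p ≡ q
⊆∧∣q∣≤∣p∣⇒≡ {p = p} {q} p⊆q ∣q∣≤∣p∣ = lookup-injective pointwise
  where
  noExcess : ∣ q ∖ p ∣ ≤ 0
  noExcess = +-cancelˡ-≤ ∣ p ∣ _ _
    (subst₂ _≤_ (⊆⇒∣q∣≡∣p∣+∣q∖p∣ p⊆q) (sym (+-identityʳ _)) ∣q∣≤∣p∣)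
  pointwise : ∀ i → lookup p i ≡ lookup q i
  pointwise i with lookup p i in pi
  ... | true  = sym (⊆⇒lookup p⊆q i pi)
  ... | false with lookup q i in qi
  ...   | false = refl
  ...   | true  = ⊥-elim (1≰0 (≤-trans (≤-reflexive (cong₂ (λ a b → 𝟙 (a ∧ not b)) (sym qi) (sym pi)))
                                   (≤-trans (∑ᵥ-≤ (λ j → 𝟙 (lookup q j ∧ not (lookup p j))) i) noExcess)))
    where
    1≰0 : ¬ 1 ≤ 0
    1≰0 ()

⊆∧1+∣p∣≡∣q∣⇒≡-x : ∀ {p q : Subset n} → p ⊆ q → suc ∣ p ∣ ≡ ∣ q ∣ →
  Σ (Fin n) λ x → lookup q x ≡ true × lookup p x ≡ false × p ≡ q - x
⊆∧1+∣p∣≡∣q∣⇒≡-x {p = p} {q} p⊆q size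
  with ∑ᵥ-positive (λ i → 𝟙 (lookup q i ∧ not (lookup p i)))
         (subst (0 <_) (+-cancelˡ-≡ ∣ p ∣ _ _ (trans (+-comm ∣ p ∣ 1) (trans size (⊆⇒∣q∣≡∣p∣+∣q∖p∣ p⊆q)))) (s≤s z≤n))
... | x , pos with ∧-true⁻ (𝟙-positive pos)
...   | qx , ¬px = x , qx , px , ⊆∧∣q∣≤∣p∣⇒≡ p⊆q-x (≤-reflexive (suc-injective (trans (sym (∣p∣≡1+∣p-x∣ q x qx)) (sym size))))
  where
  px : lookup p x ≡ false
  px = not-injective ¬px
  p⊆q-x : p ⊆ q - x
  p⊆q-x = lookup⇒⊆ λ i pi → lookup[p-y]x≡true q (⊆⇒lookup p⊆q i pi) (lookup-true-false⇒≢ p pi px)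

p-x∪⁅x⁆≡p : ∀ (p : Subset n) x → lookup p x ≡ true → (p - x) ∪ ⁅ x ⁆ ≡ p
p-x∪⁅x⁆≡p p x px = lookup-injective λ i →
  trans (lookup-∪⁅⁆ (p - x) x i) (trans (cong (_∨ (i == x)) (lookup[p-x] p x i)) (pointwise i))
  where
  pointwise : ∀ i → ((lookup p i ∧ not (i == x)) ∨ (i == x)) ≡ lookup p i
  pointwise i with i == x in i=x | lookup p i in pi
  ... | true  | true  = refl
  ... | true  | false = ⊥-elim (true≢false (trans (sym px) (subst (λ j → lookup p j ≡ false) (==⇒≡ i=x) pi)))
  ... | false | true  = refl
  ... | false | false = refl

⊆∧1+∣p∣≡∣q∣⇒q≡p∪⁅x⁆ : ∀ {p q : Subset n} → p ⊆ q → suc ∣ p ∣ ≡ ∣ q ∣ →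
  Σ (Fin n) λ x → lookup q x ≡ true × lookup p x ≡ false × q ≡ p ∪ ⁅ x ⁆
⊆∧1+∣p∣≡∣q∣⇒q≡p∪⁅x⁆ {q = q} p⊆q size with ⊆∧1+∣p∣≡∣q∣⇒≡-x p⊆q size
... | x , qx , px , p≡q-x = x , qx , px , trans (sym (p-x∪⁅x⁆≡p q x qx)) (cong (_∪ ⁅ x ⁆) (sym p≡q-x))

⊆∧∣q∣≡m+∣p∣⇒∣q∖p∣≡m : ∀ {p q : Subset n} m → p ⊆ q → ∣ q ∣ ≡ m + ∣ p ∣ →
  ∣ q ∖ p ∣ ≡ m
⊆∧∣q∣≡m+∣p∣⇒∣q∖p∣≡m {p = p} m p⊆q size =
  +-cancelˡ-≡ ∣ p ∣ _ _ (trans (sym (⊆⇒∣q∣≡∣p∣+∣q∖p∣ p⊆q)) (trans size (+-comm m ∣ p ∣)))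

≡ᵇ-true⇒≡ : ∀ {m n} → (m ≡ᵇ n) ≡ true → m ≡ n
≡ᵇ-true⇒≡ {m} {n} eq = ≡ᵇ⇒≡ m n (subst T (sym eq) _)

≡⇒≡ᵇ-true : ∀ {m n} → m ≡ n → (m ≡ᵇ n) ≡ true
≡⇒≡ᵇ-true {zero}  refl = refl
≡⇒≡ᵇ-true {suc m} refl = ≡⇒≡ᵇ-true {m} refl

≡ᵇ-false⇒≢ : ∀ {m n} → (m ≡ᵇ n) ≡ false → m ≢ n
≡ᵇ-false⇒≢ eq m≡n = true≢false (trans (sym (≡⇒≡ᵇ-true m≡n)) eq)

opaque
  _⊆ᵇ_ : Subset n → Subset n → Bool
  p ⊆ᵇ q = does (p ⊆? q)

  does-⊆?≡⊆ᵇ : ∀ (p q : Subset n) → does (p ⊆? q) ≡ (p ⊆ᵇ q)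
  does-⊆?≡⊆ᵇ p q = refl

  ⊆ᵇ⇒⊆ : ∀ {p q : Subset n} → (p ⊆ᵇ q) ≡ true → p ⊆ q
  ⊆ᵇ⇒⊆ {p = p} {q} eq with p ⊆? q
  ... | yes p⊆q = p⊆q

  ⊆⇒⊆ᵇ : ∀ {p q : Subset n} → p ⊆ q → (p ⊆ᵇ q) ≡ true
  ⊆⇒⊆ᵇ {p = p} {q} p⊆q with p ⊆? q
  ... | yes _   = refl
  ... | no  p⊈q = ⊥-elim (p⊈q p⊆q)

⊆ᵇ-p-x : ∀ (q p : Subset n) x → (q ⊆ᵇ (p - x)) ≡ (q ⊆ᵇ p ∧ not (lookup q x))
⊆ᵇ-p-x q p x = Bool-ext to from
  where
  to : (q ⊆ᵇ (p - x)) ≡ true → (q ⊆ᵇ p ∧ not (lookup q x)) ≡ true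
  to eq = ∧-true⁺ (⊆⇒⊆ᵇ (⊆-trans q⊆p-x (p-x⊆p p x))) (cong not (⊆⇒lookup-false q⊆p-x (lookup[p-x]x≡false p x)))
    where
    q⊆p-x : q ⊆ p - x
    q⊆p-x = ⊆ᵇ⇒⊆ eq
  from : (q ⊆ᵇ p ∧ not (lookup q x)) ≡ true → (q ⊆ᵇ (p - x)) ≡ true
  from eq with ∧-true⁻ eq
  ... | q⊆p , ¬qx = ⊆⇒⊆ᵇ (lookup⇒⊆ λ i qi →
    lookup[p-y]x≡true p (⊆⇒lookup (⊆ᵇ⇒⊆ q⊆p) i qi) (lookup-true-false⇒≢ q qi (not-injective ¬qx)))

⊆ᵇ-p∪⁅x⁆ : ∀ (p q : Subset n) x → ((p ∪ ⁅ x ⁆) ⊆ᵇ q) ≡ (p ⊆ᵇ q ∧ lookup q x)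
⊆ᵇ-p∪⁅x⁆ p q x = Bool-ext to from
  where
  to : ((p ∪ ⁅ x ⁆) ⊆ᵇ q) ≡ true → (p ⊆ᵇ q ∧ lookup q x) ≡ true
  to eq = ∧-true⁺ (⊆⇒⊆ᵇ (⊆-trans (p⊆p∪⁅x⁆ p x) p∪x⊆q))
                  (⊆⇒lookup p∪x⊆q x (trans (lookup-∪⁅⁆ p x x) (trans (cong (lookup p x ∨_) (==-refl x)) (∨-zeroʳ _))))
    where
    p∪x⊆q : p ∪ ⁅ x ⁆ ⊆ q
    p∪x⊆q = ⊆ᵇ⇒⊆ eq
  from : (p ⊆ᵇ q ∧ lookup q x) ≡ true → ((p ∪ ⁅ x ⁆) ⊆ᵇ q) ≡ true
  from eq with ∧-true⁻ eq
  ... | p⊆q , qx = ⊆⇒⊆ᵇ (p∪⁅x⁆⊆q (⊆ᵇ⇒⊆ p⊆q) qx)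

opaque
  _=ˢ_ : Subset n → Subset n → Bool
  p =ˢ q = does (≡-dec _≟ᵇ_ p q)

  =ˢ-refl : ∀ (p : Subset n) → (p =ˢ p) ≡ true
  =ˢ-refl p with ≡-dec _≟ᵇ_ p p
  ... | yes _   = refl
  ... | no  p≢p = ⊥-elim (p≢p refl)

  ≢⇒=ˢ-false : ∀ {p q : Subset n} → p ≢ q → (p =ˢ q) ≡ false
  ≢⇒=ˢ-false {p = p} {q} p≢q with ≡-dec _≟ᵇ_ p q
  ... | yes p≡q = ⊥-elim (p≢q p≡q)
  ... | no  _   = refl

  =ˢ⇒≡ : ∀ {p q : Subset n} → (p =ˢ q) ≡ true → p ≡ q
  =ˢ⇒≡ {p = p} {q} eq with ≡-dec _≟ᵇ_ p q
  ... | yes p≡q = p≡q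

∑ₛ-=ˢ : ∀ (q : Subset n) (g : Subset n → ℕ) → ∑ₛ (λ p → 𝟙 (p =ˢ q) * g p) ≡ g q
∑ₛ-=ˢ q g = trans (∑ₛ-single _ q λ p p≢q → cong (λ b → 𝟙 b * g p) (≢⇒=ˢ-false p≢q))
                  (trans (cong (λ b → 𝟙 b * g q) (=ˢ-refl q)) (+-identityʳ _))

𝟙*𝟙≡0 : ∀ a b → (a ≡ true → b ≡ true → ⊥) → 𝟙 a * 𝟙 b ≡ 0
𝟙*𝟙≡0 false b     _ = refl
𝟙*𝟙≡0 true  false _ = refl
𝟙*𝟙≡0 true  true  h = ⊥-elim (h refl refl)

𝟙*𝟙≡1⁻ : ∀ {a b} → 𝟙 a * 𝟙 b ≡ 1 → a ≡ true × b ≡ true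
𝟙*𝟙≡1⁻ {true} {true} _ = refl , refl

𝟙*𝟙≡0⁻ : ∀ {a b} → 𝟙 a * 𝟙 b ≡ 0 → a ≡ true → b ≡ false
𝟙*𝟙≡0⁻ {true} {false} _ _ = refl

f[b]+f[c]≤∑ᵥf : ∀ (f : Fin n → ℕ) {b c} → b ≢ c → f b + f c ≤ ∑ᵥ f
f[b]+f[c]≤∑ᵥf f {b} {c} b≢c = subst (_≤ ∑ᵥ f) (trans (∑ᵥ-distrib-+ _ _) (cong₂ _+_ (∑ᵥ-== b f) (∑ᵥ-== c f)))
                                     (∑ᵥ-mono-≤ pointwise)
  where
  pointwise : ∀ i → 𝟙 (i == b) * f i + 𝟙 (i == c) * f i ≤ f i
  pointwise i with i == b in i=b | i == c in i=c
  ... | true  | true  = ⊥-elim (b≢c (trans (sym (==⇒≡ i=b)) (==⇒≡ i=c)))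
  ... | true  | false = ≤-reflexive (trans (+-identityʳ _) (+-identityʳ _))
  ... | false | true  = ≤-reflexive (+-identityʳ _)
  ... | false | false = z≤n

∑ᵥf≤f[b]⇒f[c]≡0 : ∀ (f : Fin n → ℕ) {b c} → ∑ᵥ f ≤ f b → c ≢ b → f c ≡ 0
∑ᵥf≤f[b]⇒f[c]≡0 f {b} {c} ∑≤fb c≢b =
  n≤0⇒n≡0 (+-cancelˡ-≤ (f b) _ _ (subst (f b + f c ≤_) (sym (+-identityʳ (f b)))
                                        (≤-trans (f[b]+f[c]≤∑ᵥf f (λ b≡c → c≢b (sym b≡c))) ∑≤fb)))

removal-count : ∀ (p q : Subset n) →
  ∑ᵥ (λ x → 𝟙 (lookup p x) * 𝟙 (q =ˢ (p - x))) ≡ 𝟙 (q ⊆ᵇ p) * 𝟙 (suc ∣ q ∣ ≡ᵇ ∣ p ∣)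
removal-count p q with q ⊆ᵇ p in q⊆p | suc ∣ q ∣ ≡ᵇ ∣ p ∣ in size
... | true  | true  = unique (⊆∧1+∣p∣≡∣q∣⇒≡-x (⊆ᵇ⇒⊆ q⊆p) (≡ᵇ-true⇒≡ size))
  where
  unique : (Σ (Fin _) λ x → lookup p x ≡ true × lookup q x ≡ false × q ≡ p - x) →
    ∑ᵥ (λ x → 𝟙 (lookup p x) * 𝟙 (q =ˢ (p - x))) ≡ 1
  unique (x , px , qx , q≡p-x) =
    trans (∑ᵥ-single _ x others) (cong₂ (λ a b → 𝟙 a * 𝟙 b) px (trans (cong (q =ˢ_) (sym q≡p-x)) (=ˢ-refl q)))
    where
    others : ∀ y → y ≢ x → 𝟙 (lookup p y) * 𝟙 (q =ˢ (p - y)) ≡ 0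
    others y y≢x = 𝟙*𝟙≡0 (lookup p y) (q =ˢ (p - y)) λ _ q=p-y → true≢false
      (trans (sym (lookup[p-y]x≡true p px (λ x≡y → y≢x (sym x≡y)))) (trans (cong (λ r → lookup r x) (sym (=ˢ⇒≡ q=p-y))) qx))
... | true  | false = ∑ᵥ-zero λ y → 𝟙*𝟙≡0 (lookup p y) (q =ˢ (p - y)) λ py q=p-y →
  ≡ᵇ-false⇒≢ size (trans (cong (λ r → suc ∣ r ∣) (=ˢ⇒≡ q=p-y)) (sym (∣p∣≡1+∣p-x∣ p y py)))
... | false | _     = ∑ᵥ-zero λ y → 𝟙*𝟙≡0 (lookup p y) (q =ˢ (p - y)) λ _ q=p-y →
  true≢false (trans (sym (⊆⇒⊆ᵇ (subst (_⊆ p) (sym (=ˢ⇒≡ q=p-y)) (p-x⊆p p y)))) q⊆p)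

∑-removals : ∀ (p : Subset n) (g : Subset n → ℕ) →
  ∑ᵥ (λ x → 𝟙 (lookup p x) * g (p - x)) ≡ ∑ₛ (λ q → (𝟙 (q ⊆ᵇ p) * 𝟙 (suc ∣ q ∣ ≡ᵇ ∣ p ∣)) * g q)
∑-removals p g = begin
  ∑ᵥ (λ x → 𝟙 (lookup p x) * g (p - x))
    ≡⟨ ∑ᵥ-cong (λ x → cong (𝟙 (lookup p x) *_) (sym (∑ₛ-=ˢ (p - x) g))) ⟩
  ∑ᵥ (λ x → 𝟙 (lookup p x) * ∑ₛ (λ q → 𝟙 (q =ˢ (p - x)) * g q))
    ≡⟨ ∑ᵥ-cong (λ x → sym (∑ₛ-*ˡ (𝟙 (lookup p x)) _)) ⟩
  ∑ᵥ (λ x → ∑ₛ (λ q → 𝟙 (lookup p x) * (𝟙 (q =ˢ (p - x)) * g q)))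
    ≡⟨ ∑ᵥ∑ₛ-comm _ ⟩
  ∑ₛ (λ q → ∑ᵥ (λ x → 𝟙 (lookup p x) * (𝟙 (q =ˢ (p - x)) * g q)))
    ≡⟨ ∑ₛ-cong (λ q → trans (∑ᵥ-cong λ x → sym (*-assoc (𝟙 (lookup p x)) _ (g q))) (∑ᵥ-*ʳ (g q) _)) ⟩
  ∑ₛ (λ q → ∑ᵥ (λ x → 𝟙 (lookup p x) * 𝟙 (q =ˢ (p - x))) * g q)
    ≡⟨ ∑ₛ-cong (λ q → cong (_* g q) (removal-count p q)) ⟩
  ∑ₛ (λ q → (𝟙 (q ⊆ᵇ p) * 𝟙 (suc ∣ q ∣ ≡ᵇ ∣ p ∣)) * g q) ∎
  where open ≡-Reasoning

∑pairs : Subset n → (Subset n → ℕ) → ℕ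
∑pairs p w = ∑ᵥ (λ x → ∑ᵥ (λ y → 𝟙 (lookup p x) * (𝟙 (lookup (p - x) y) * w (p - x - y))))

∑pairs≡2∑ : ∀ (p : Subset n) k (g : Subset n → ℕ) → ∣ p ∣ ≡ 2 + k →
  ∑pairs p g ≡ 2 * ∑ₛ (λ q → 𝟙 (q ⊆ᵇ p) * (𝟙 (∣ q ∣ ≡ᵇ k) * g q))
∑pairs≡2∑ p k g size = begin
  ∑pairs p g
    ≡⟨ ∑ᵥ-cong (λ x → trans (∑ᵥ-*ˡ (𝟙 (lookup p x)) _) (removeSecond x)) ⟩
  ∑ᵥ (λ x → ∑ₛ (λ q → 𝟙 (lookup p x) * ((𝟙 (q ⊆ᵇ (p - x)) * 𝟙 (∣ q ∣ ≡ᵇ k)) * g q)))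
    ≡⟨ ∑ᵥ∑ₛ-comm _ ⟩
  ∑ₛ (λ q → ∑ᵥ (λ x → 𝟙 (lookup p x) * ((𝟙 (q ⊆ᵇ (p - x)) * 𝟙 (∣ q ∣ ≡ᵇ k)) * g q)))
    ≡⟨ ∑ₛ-cong removeFirst ⟩
  ∑ₛ (λ q → 2 * (𝟙 (q ⊆ᵇ p) * (𝟙 (∣ q ∣ ≡ᵇ k) * g q)))
    ≡⟨ ∑ₛ-*ˡ 2 _ ⟩
  2 * ∑ₛ (λ q → 𝟙 (q ⊆ᵇ p) * (𝟙 (∣ q ∣ ≡ᵇ k) * g q)) ∎
  where
  open ≡-Reasoning
  removeSecond : ∀ x → 𝟙 (lookup p x) * ∑ᵥ (λ y → 𝟙 (lookup (p - x) y) * g (p - x - y))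
                     ≡ ∑ₛ (λ q → 𝟙 (lookup p x) * ((𝟙 (q ⊆ᵇ (p - x)) * 𝟙 (∣ q ∣ ≡ᵇ k)) * g q))
  removeSecond x with lookup p x in px
  ... | false = sym (∑ₛ-zero λ _ → refl)
  ... | true  = trans (+-identityʳ _) (trans (∑-removals (p - x) g) (∑ₛ-cong λ q →
                  trans (cong (λ m → (𝟙 (q ⊆ᵇ (p - x)) * 𝟙 (suc ∣ q ∣ ≡ᵇ m)) * g q) ∣p-x∣≡1+k)
                        (sym (+-identityʳ _))))
    where
    ∣p-x∣≡1+k : ∣ p - x ∣ ≡ suc k
    ∣p-x∣≡1+k = suc-injective (trans (sym (∣p∣≡1+∣p-x∣ p x px)) size)
  removeFirst : ∀ q → ∑ᵥ (λ x → 𝟙 (lookup p x) * ((𝟙 (q ⊆ᵇ (p - x)) * 𝟙 (∣ q ∣ ≡ᵇ k)) * g q))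
                    ≡ 2 * (𝟙 (q ⊆ᵇ p) * (𝟙 (∣ q ∣ ≡ᵇ k) * g q))
  removeFirst q = trans (∑ᵥ-cong λ x → cong (λ b → 𝟙 (lookup p x) * ((𝟙 b * 𝟙 (∣ q ∣ ≡ᵇ k)) * g q)) (⊆ᵇ-p-x q p x))
                        (cases (q ⊆ᵇ p) refl (∣ q ∣ ≡ᵇ k) refl)
    where
    cases : ∀ a → (q ⊆ᵇ p) ≡ a → ∀ b → (∣ q ∣ ≡ᵇ k) ≡ b →
      ∑ᵥ (λ x → 𝟙 (lookup p x) * ((𝟙 (a ∧ not (lookup q x)) * 𝟙 b) * g q)) ≡ 2 * (𝟙 a * (𝟙 b * g q))
    cases false _ b _ = ∑ᵥ-zero λ x → *-zeroʳ (𝟙 (lookup p x))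
    cases true  _ false _ = ∑ᵥ-zero λ x →
      trans (cong (λ m → 𝟙 (lookup p x) * (m * g q)) (*-zeroʳ (𝟙 (not (lookup q x))))) (*-zeroʳ (𝟙 (lookup p x)))
    cases true  q⊆p true ∣q∣≡k = begin
      ∑ᵥ (λ x → 𝟙 (lookup p x) * ((𝟙 (not (lookup q x)) * 1) * g q))
        ≡⟨ ∑ᵥ-cong (λ x → trans (regroup (𝟙 (lookup p x)) (𝟙 (not (lookup q x))) (g q))
                               (cong (_* g q) (sym (𝟙-∧ (lookup p x) (not (lookup q x)))))) ⟩
      ∑ᵥ (λ x → 𝟙 (lookup p x ∧ not (lookup q x)) * g q)
        ≡⟨ ∑ᵥ-*ʳ (g q) _ ⟩
      ∣ p ∖ q ∣ * g q
        ≡⟨ cong (_* g q) (⊆∧∣q∣≡m+∣p∣⇒∣q∖p∣≡m 2 (⊆ᵇ⇒⊆ q⊆p) (trans size (cong (2 +_) (sym (≡ᵇ-true⇒≡ ∣q∣≡k))))) ⟩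
      2 * g q
        ≡⟨ cong (2 *_) (sym (trans (+-identityʳ (1 * g q)) (+-identityʳ (g q)))) ⟩
      2 * (1 * (1 * g q)) ∎
      where
      regroup : ∀ a b c → a * ((b * 1) * c) ≡ (a * b) * c
      regroup = solve-∀

∑pairs-cong : ∀ (p : Subset n) {v w : Subset n → ℕ} → (∀ q → v q ≡ w q) → ∑pairs p v ≡ ∑pairs p w
∑pairs-cong p h = ∑ᵥ-cong λ x → ∑ᵥ-cong λ y → cong (λ m → 𝟙 (lookup p x) * (𝟙 (lookup (p - x) y) * m)) (h _)

∑pairs-mono-≤ : ∀ (p : Subset n) {v w : Subset n → ℕ} →
  (∀ x y → lookup p x ≡ true → lookup (p - x) y ≡ true → v (p - x - y) ≤ w (p - x - y)) →
  ∑pairs p v ≤ ∑pairs p w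
∑pairs-mono-≤ p {v} {w} h = ∑ᵥ-mono-≤ λ x → ∑ᵥ-mono-≤ λ y → pointwise x y
  where
  pointwise : ∀ x y → 𝟙 (lookup p x) * (𝟙 (lookup (p - x) y) * v (p - x - y))
                    ≤ 𝟙 (lookup p x) * (𝟙 (lookup (p - x) y) * w (p - x - y))
  pointwise x y with lookup p x in px | lookup (p - x) y in pxy
  ... | false | _     = z≤n
  ... | true  | false = z≤n
  ... | true  | true  = +-mono-≤ (+-mono-≤ (h x y px pxy) z≤n) z≤n

∑pairs-distrib-+ : ∀ (p : Subset n) v w → ∑pairs p (λ q → v q + w q) ≡ ∑pairs p v + ∑pairs p w
∑pairs-distrib-+ p v w = trans
  (∑ᵥ-cong λ x → trans (∑ᵥ-cong λ y → distrib (𝟙 (lookup p x)) (𝟙 (lookup (p - x) y)) (v (p - x - y)) (w (p - x - y)))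
                       (∑ᵥ-distrib-+ _ _))
  (∑ᵥ-distrib-+ _ _)
  where
  distrib : ∀ a b c d → a * (b * (c + d)) ≡ a * (b * c) + a * (b * d)
  distrib = solve-∀

∑pairs-*ˡ : ∀ (p : Subset n) c w → ∑pairs p (λ q → c * w q) ≡ c * ∑pairs p w
∑pairs-*ˡ p c w = trans
  (∑ᵥ-cong λ x → trans (∑ᵥ-cong λ y → regroup (𝟙 (lookup p x)) (𝟙 (lookup (p - x) y)) c (w (p - x - y)))
                       (∑ᵥ-*ˡ c _))
  (∑ᵥ-*ˡ c _)
  where
  regroup : ∀ a b c d → a * (b * (c * d)) ≡ c * (a * (b * d))
  regroup = solve-∀

∑pairs-∑ᵥ : ∀ (p : Subset n) (F : Fin n → Subset n → ℕ) →
  ∑pairs p (λ q → ∑ᵥ (λ z → F z q)) ≡ ∑ᵥ (λ z → ∑pairs p (F z))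
∑pairs-∑ᵥ p F = begin
  ∑pairs p (λ q → ∑ᵥ (λ z → F z q))
    ≡⟨ ∑ᵥ-cong (λ x → ∑ᵥ-cong λ y → trans (cong (𝟙 (lookup p x) *_) (sym (∑ᵥ-*ˡ (𝟙 (lookup (p - x) y)) _)))
                                          (sym (∑ᵥ-*ˡ (𝟙 (lookup p x)) _))) ⟩
  ∑ᵥ (λ x → ∑ᵥ (λ y → ∑ᵥ (λ z → 𝟙 (lookup p x) * (𝟙 (lookup (p - x) y) * F z (p - x - y)))))
    ≡⟨ ∑ᵥ-cong (λ x → ∑ᵥ-comm _) ⟩
  ∑ᵥ (λ x → ∑ᵥ (λ z → ∑ᵥ (λ y → 𝟙 (lookup p x) * (𝟙 (lookup (p - x) y) * F z (p - x - y)))))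
    ≡⟨ ∑ᵥ-comm _ ⟩
  ∑ᵥ (λ z → ∑pairs p (F z)) ∎
  where open ≡-Reasoning

∑pairs-1 : ∀ (p : Subset n) k → ∣ p ∣ ≡ suc k → ∑pairs p (λ _ → 1) ≡ suc k * k
∑pairs-1 p k size = begin
  ∑pairs p (λ _ → 1)                    ≡⟨ ∑ᵥ-cong inner ⟩
  ∑ᵥ (λ x → k * 𝟙 (lookup p x))         ≡⟨ ∑ᵥ-*ˡ k _ ⟩
  k * ∑ᵥ (λ x → 𝟙 (lookup p x))         ≡⟨ cong (k *_) (trans (sym (∣p∣≡∑ p)) size) ⟩
  k * suc k                             ≡⟨ *-comm k (suc k) ⟩
  suc k * k                             ∎
  where
  open ≡-Reasoning
  inner : ∀ x → ∑ᵥ (λ y → 𝟙 (lookup p x) * (𝟙 (lookup (p - x) y) * 1)) ≡ k * 𝟙 (lookup p x)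
  inner x with lookup p x in px
  ... | false = trans (∑ᵥ-zero λ _ → refl) (sym (*-zeroʳ k))
  ... | true  = begin
    ∑ᵥ (λ y → 1 * (𝟙 (lookup (p - x) y) * 1)) ≡⟨ ∑ᵥ-cong (λ y → trans (+-identityʳ _) (*-identityʳ _)) ⟩
    ∑ᵥ (λ y → 𝟙 (lookup (p - x) y))           ≡⟨ sym (∣p∣≡∑ (p - x)) ⟩
    ∣ p - x ∣                                 ≡⟨ suc-injective (trans (sym (∣p∣≡1+∣p-x∣ p x px)) size) ⟩
    k                                         ≡⟨ sym (*-identityʳ k) ⟩
    k * 1                                     ∎

allᵇ-++ : ∀ (P : A → Bool) xs ys → allᵇ P (xs ++ ys) ≡ (allᵇ P xs ∧ allᵇ P ys)
allᵇ-++ P []       ys = refl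
allᵇ-++ P (x ∷ xs) ys rewrite allᵇ-++ P xs ys = sym (∧-assoc (P x) _ _)

allᵇ-map : ∀ (P : A → Bool) (f : B → A) xs → allᵇ P (map f xs) ≡ allᵇ (λ x → P (f x)) xs
allᵇ-map P f []       = refl
allᵇ-map P f (x ∷ xs) = cong (P (f x) ∧_) (allᵇ-map P f xs)

allᵇ-allSubsets-suc : ∀ (P : Subset (suc n) → Bool) → allᵇ P (allSubsets (suc n))
  ≡ (allᵇ (λ q → P (false ∷ q)) (allSubsets n) ∧ allᵇ (λ q → P (true ∷ q)) (allSubsets n))
allᵇ-allSubsets-suc {n} P =
  trans (allᵇ-++ P (map (false ∷_) (allSubsets n)) (map (true ∷_) (allSubsets n)))
        (cong₂ _∧_ (allᵇ-map P (false ∷_) (allSubsets n)) (allᵇ-map P (true ∷_) (allSubsets n)))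

allᵇ-allSubsets⁻ : ∀ (P : Subset n → Bool) → allᵇ P (allSubsets n) ≡ true → ∀ p → P p ≡ true
allᵇ-allSubsets⁻ {zero}  P all [] = proj₁ (∧-true⁻ all)
allᵇ-allSubsets⁻ {suc n} P all (false ∷ p) =
  allᵇ-allSubsets⁻ _ (proj₁ (∧-true⁻ (trans (sym (allᵇ-allSubsets-suc P)) all))) p
allᵇ-allSubsets⁻ {suc n} P all (true ∷ p) =
  allᵇ-allSubsets⁻ _ (proj₂ (∧-true⁻ (trans (sym (allᵇ-allSubsets-suc P)) all))) p

allᵇ-allSubsets⁺ : ∀ (P : Subset n → Bool) → (∀ p → P p ≡ true) → allᵇ P (allSubsets n) ≡ true
allᵇ-allSubsets⁺ {zero}  P h rewrite h [] = refl
allᵇ-allSubsets⁺ {suc n} P h = trans (allᵇ-allSubsets-suc P)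
  (∧-true⁺ (allᵇ-allSubsets⁺ _ (λ q → h (false ∷ q))) (allᵇ-allSubsets⁺ _ (λ q → h (true ∷ q))))

-- Binomial coefficients

nC0≡1 : ∀ n → n C 0 ≡ 1
nC0≡1 n = trans (nCk≡nC[n∸k] {0} {n} z≤n) (nCn≡1 n)

∑ₛ-∣∣≡k : ∀ n k → ∑ₛ {n} (λ p → 𝟙 (∣ p ∣ ≡ᵇ k)) ≡ n C k
∑ₛ-∣∣≡k zero    zero    = ∑ₛ-Subset0 _
∑ₛ-∣∣≡k zero    (suc k) = trans (∑ₛ-Subset0 _) (sym (k>n⇒nCk≡0 {0} {suc k} (s≤s z≤n)))
∑ₛ-∣∣≡k (suc n) zero    = begin
  ∑ₛ (λ p → 𝟙 (∣ p ∣ ≡ᵇ 0))                                   ≡⟨ ∑ₛ-suc _ ⟩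
  ∑ₛ (λ p → 𝟙 (∣ p ∣ ≡ᵇ 0)) + ∑ₛ (λ p → 𝟙 (suc ∣ p ∣ ≡ᵇ 0))   ≡⟨ cong₂ _+_ (∑ₛ-∣∣≡k n 0) (∑ₛ-zero λ _ → refl) ⟩
  n C 0 + 0                                                   ≡⟨ +-identityʳ _ ⟩
  n C 0                                                       ≡⟨ trans (nC0≡1 n) (sym (nC0≡1 (suc n))) ⟩
  suc n C 0                                                   ∎
  where open ≡-Reasoning
∑ₛ-∣∣≡k (suc n) (suc k) = begin
  ∑ₛ (λ p → 𝟙 (∣ p ∣ ≡ᵇ suc k))                                        ≡⟨ ∑ₛ-suc _ ⟩
  ∑ₛ (λ p → 𝟙 (∣ p ∣ ≡ᵇ suc k)) + ∑ₛ (λ p → 𝟙 (∣ p ∣ ≡ᵇ k))            ≡⟨ cong₂ _+_ (∑ₛ-∣∣≡k n (suc k)) (∑ₛ-∣∣≡k n k) ⟩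
  n C suc k + n C k                                                    ≡⟨ +-comm (n C suc k) (n C k) ⟩
  n C k + n C suc k                                                    ≡⟨ nCk+nC[k+1]≡[n+1]C[k+1] n k ⟩
  suc n C suc k                                                        ∎
  where open ≡-Reasoning

[1+k]*nC[1+k]≡[n∸k]*nCk : ∀ n k → suc k * (n C suc k) ≡ (n ∸ k) * (n C k)
[1+k]*nC[1+k]≡[n∸k]*nCk zero k rewrite k>n⇒nCk≡0 {0} {suc k} (s≤s z≤n) | 0∸n≡0 k = *-zeroʳ (suc k)
[1+k]*nC[1+k]≡[n∸k]*nCk (suc m) k = begin
  suc k * (suc m C suc k)                 ≡⟨ cong (suc k *_) (sym (nCk+nC[k+1]≡[n+1]C[k+1] m k)) ⟩
  suc k * (m C k + m C suc k)             ≡⟨ *-distribˡ-+ (suc k) (m C k) (m C suc k) ⟩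
  suc k * (m C k) + suc k * (m C suc k)   ≡⟨ cong (suc k * (m C k) +_) ([1+k]*nC[1+k]≡[n∸k]*nCk m k) ⟩
  suc k * (m C k) + (m ∸ k) * (m C k)     ≡⟨ sym (*-distribʳ-+ (m C k) (suc k) (m ∸ k)) ⟩
  (suc k + (m ∸ k)) * (m C k)             ≡⟨ absorb k ⟩
  (suc m ∸ k) * (suc m C k)               ∎
  where
  open ≡-Reasoning
  absorb : ∀ k → (suc k + (m ∸ k)) * (m C k) ≡ (suc m ∸ k) * (suc m C k)
  absorb zero rewrite nC0≡1 m | nC0≡1 (suc m) = refl
  absorb (suc j) = sym (begin
    (m ∸ j) * (suc m C suc j)                          ≡⟨ cong ((m ∸ j) *_) (sym (nCk+nC[k+1]≡[n+1]C[k+1] m j)) ⟩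
    (m ∸ j) * (m C j + m C suc j)                      ≡⟨ *-distribˡ-+ (m ∸ j) (m C j) (m C suc j) ⟩
    (m ∸ j) * (m C j) + (m ∸ j) * (m C suc j)          ≡⟨ cong (_+ (m ∸ j) * (m C suc j)) (sym ([1+k]*nC[1+k]≡[n∸k]*nCk m j)) ⟩
    suc j * (m C suc j) + (m ∸ j) * (m C suc j)        ≡⟨ sym (*-distribʳ-+ (m C suc j) (suc j) (m ∸ j)) ⟩
    (suc j + (m ∸ j)) * (m C suc j)                    ≡⟨ sameFactor ⟩
    (suc (suc j) + (m ∸ suc j)) * (m C suc j)          ∎)
    where
    sameFactor : (suc j + (m ∸ j)) * (m C suc j) ≡ (suc (suc j) + (m ∸ suc j)) * (m C suc j)
    sameFactor with j <? m
    ... | yes j<m = cong (_* (m C suc j)) (trans (cong (suc j +_) (+-∸-assoc 1 j<m)) (+-suc (suc j) (m ∸ suc j)))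
    ... | no  j≮m rewrite k>n⇒nCk≡0 {m} {suc j} (s≤s (≮⇒≥ j≮m)) =
      trans (*-zeroʳ (suc j + (m ∸ j))) (sym (*-zeroʳ (suc (suc j) + (m ∸ suc j))))

2xy≤x²+y² : ∀ x y → 2 * (x * y) ≤ x * x + y * y
2xy≤x²+y² x y = byOrder (≤-total x y)
  where
  gap : ∀ a d → 2 * (a * (a + d)) ≤ a * a + (a + d) * (a + d)
  gap a d = subst₂ _≤_ (lhs a d) (rhs a d) (m≤m+n (2 * (a * a) + 2 * (a * d)) (d * d))
    where
    lhs : ∀ a d → 2 * (a * a) + 2 * (a * d) ≡ 2 * (a * (a + d))
    lhs = solve-∀
    rhs : ∀ a d → 2 * (a * a) + 2 * (a * d) + d * d ≡ a * a + (a + d) * (a + d)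
    rhs = solve-∀
  byOrder : x ≤ y ⊎ y ≤ x → 2 * (x * y) ≤ x * x + y * y
  byOrder (inj₁ x≤y) = subst₂ _≤_ (cong (λ z → 2 * (x * z)) (m+[n∸m]≡n x≤y)) (cong (λ z → x * x + z * z) (m+[n∸m]≡n x≤y))
                              (gap x (y ∸ x))
  byOrder (inj₂ y≤x) = subst₂ _≤_ (trans (cong (2 *_) (*-comm y (y + (x ∸ y)))) (cong (λ z → 2 * (z * y)) (m+[n∸m]≡n y≤x)))
                              (trans (cong (λ z → y * y + z * z) (m+[n∸m]≡n y≤x)) (+-comm (y * y) (x * x)))
                              (gap y (x ∸ y))

-- Summing 2(q d)G ≤ (q d)² + G² against the weights w: a Cauchy–Schwarz bound for the mean of d.
mean-square-bound : ∀ (w d : Subset n → ℕ) q G e .{{_ : NonZero G}} →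
  ∑ₛ (λ Y → w Y * d Y) ≡ q * e → ∑ₛ (λ Y → w Y * (d Y * d Y)) ≤ G * e → q * q * e ≤ G * ∑ₛ w
mean-square-bound w d q G e ∑wd≡qe ∑wd²≤Ge =
  *-cancelˡ-≤ G (+-cancelˡ-≤ (q * q * (G * e)) _ _ (begin
    q * q * (G * e) + G * (q * q * e)              ≡⟨ regroupˡ q G e ⟩
    (2 * q * G) * (q * e)                          ≡⟨ cong ((2 * q * G) *_) (sym ∑wd≡qe) ⟩
    (2 * q * G) * ∑ₛ (λ Y → w Y * d Y)             ≡⟨ sym (∑ₛ-*ˡ (2 * q * G) _) ⟩
    ∑ₛ (λ Y → (2 * q * G) * (w Y * d Y))           ≤⟨ ∑ₛ-mono-≤ amgm ⟩
    ∑ₛ (λ Y → (q * q) * (w Y * (d Y * d Y)) + (G * G) * w Y)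
                                                   ≡⟨ ∑ₛ-distrib-+ _ _ ⟩
    ∑ₛ (λ Y → (q * q) * (w Y * (d Y * d Y))) + ∑ₛ (λ Y → (G * G) * w Y)
                                                   ≡⟨ cong₂ _+_ (∑ₛ-*ˡ (q * q) _) (∑ₛ-*ˡ (G * G) w) ⟩
    (q * q) * ∑ₛ (λ Y → w Y * (d Y * d Y)) + (G * G) * ∑ₛ w
                                                   ≤⟨ +-monoˡ-≤ _ (*-monoʳ-≤ (q * q) ∑wd²≤Ge) ⟩
    (q * q) * (G * e) + (G * G) * ∑ₛ w             ≡⟨ regroupʳ q G e (∑ₛ w) ⟩
    q * q * (G * e) + G * (G * ∑ₛ w)               ∎))
  where
  open ≤-Reasoning
  amgm : ∀ Y → (2 * q * G) * (w Y * d Y) ≤ (q * q) * (w Y * (d Y * d Y)) + (G * G) * w Y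
  amgm Y = subst₂ _≤_ (lhs (w Y) (d Y) q G) (rhs (w Y) (d Y) q G) (*-monoʳ-≤ (w Y) (2xy≤x²+y² (q * d Y) G))
    where
    lhs : ∀ w d q G → w * (2 * ((q * d) * G)) ≡ (2 * q * G) * (w * d)
    lhs = solve-∀
    rhs : ∀ w d q G → w * ((q * d) * (q * d) + G * G) ≡ (q * q) * (w * (d * d)) + (G * G) * w
    rhs = solve-∀
  regroupˡ : ∀ q G e → q * q * (G * e) + G * (q * q * e) ≡ (2 * q * G) * (q * e)
  regroupˡ = solve-∀
  regroupʳ : ∀ q G e N → (q * q) * (G * e) + (G * G) * N ≡ q * q * (G * e) + G * (G * N)
  regroupʳ = solve-∀

2m≤3t⇒[2m+2]/3≤t : ∀ m t → 2 * m ≤ 3 * t → (2 * m + 2) / 3 ≤ t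
2m≤3t⇒[2m+2]/3≤t m t le = s≤s⁻¹ (m<n*o⇒m/o<n {2 * m + 2} {suc t} {3} (subst (2 * m + 2 <_) (eq t) (s≤s (+-monoˡ-≤ 2 le))))
  where
  eq : ∀ t → suc (3 * t + 2) ≡ suc t * 3
  eq = solve-∀

-- Leaves (vertices of degree one) are never adjacent, so each leaf sends its edge to a vertex of
-- degree at least two; counting these edges from the other end gives #leaves ≤ ∑ of the other degrees.
module DegreeBound {n} (V : Fin n → Bool) (M : Fin n → Fin n → ℕ)
  (M≤1        : ∀ a b → M a b ≤ 1)
  (M-closed   : ∀ a b → V a ≡ true → M a b ≡ 1 → V b ≡ true)
  (M-sym      : ∀ a b → V a ≡ true → V b ≡ true → M a b ≡ M b a)
  (no-isolated : ∀ a → V a ≡ true → 1 ≤ ∑ᵥ (M a))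
  (no-leaf-edge : ∀ a b → V a ≡ true → M a b ≡ 1 → ∑ᵥ (M a) ≡ 1 → ∑ᵥ (M b) ≡ 1 → ⊥) where

  deg : Fin n → ℕ
  deg a = ∑ᵥ (M a)

  leaf : Fin n → Bool
  leaf a = deg a ≡ᵇ 1

  #leaves #inner innerDegrees : ℕ
  #leaves      = ∑ᵥ (λ a → 𝟙 (V a) * 𝟙 (leaf a))
  #inner       = ∑ᵥ (λ a → 𝟙 (V a) * 𝟙 (not (leaf a)))
  innerDegrees = ∑ᵥ (λ a → 𝟙 (V a) * (𝟙 (not (leaf a)) * deg a))

  ∣V∣≡#leaves+#inner : ∑ᵥ (λ a → 𝟙 (V a)) ≡ #leaves + #inner
  ∣V∣≡#leaves+#inner = trans (∑ᵥ-cong pointwise) (∑ᵥ-distrib-+ _ _)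
    where
    pointwise : ∀ a → 𝟙 (V a) ≡ 𝟙 (V a) * 𝟙 (leaf a) + 𝟙 (V a) * 𝟙 (not (leaf a))
    pointwise a with V a | leaf a
    ... | false | _     = refl
    ... | true  | true  = refl
    ... | true  | false = refl

  ∑deg≡#leaves+innerDegrees : ∑ᵥ (λ a → 𝟙 (V a) * deg a) ≡ #leaves + innerDegrees
  ∑deg≡#leaves+innerDegrees = trans (∑ᵥ-cong pointwise) (∑ᵥ-distrib-+ _ _)
    where
    pointwise : ∀ a → 𝟙 (V a) * deg a ≡ 𝟙 (V a) * 𝟙 (leaf a) + 𝟙 (V a) * (𝟙 (not (leaf a)) * deg a)
    pointwise a with V a | leaf a in isLeaf
    ... | false | _     = refl
    ... | true  | true  = trans (+-identityʳ _) (≡ᵇ-true⇒≡ isLeaf)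
    ... | true  | false = sym (+-identityʳ _)

  2*#inner≤innerDegrees : 2 * #inner ≤ innerDegrees
  2*#inner≤innerDegrees = subst (_≤ innerDegrees) (∑ᵥ-*ˡ 2 _) (∑ᵥ-mono-≤ pointwise)
    where
    pointwise : ∀ a → 2 * (𝟙 (V a) * 𝟙 (not (leaf a))) ≤ 𝟙 (V a) * (𝟙 (not (leaf a)) * deg a)
    pointwise a with V a in Va | leaf a in isLeaf
    ... | false | _     = z≤n
    ... | true  | true  = z≤n
    ... | true  | false = subst (2 ≤_) (sym (trans (+-identityʳ _) (+-identityʳ _)))
                                (≥1∧≢1⇒≥2 (no-isolated a Va) (≡ᵇ-false⇒≢ isLeaf))
      where
      ≥1∧≢1⇒≥2 : ∀ {m} → 1 ≤ m → m ≢ 1 → 2 ≤ m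
      ≥1∧≢1⇒≥2 {suc zero}    _ m≢1 = ⊥-elim (m≢1 refl)
      ≥1∧≢1⇒≥2 {suc (suc m)} _ _   = s≤s (s≤s z≤n)

  #leaves≤innerDegrees : #leaves ≤ innerDegrees
  #leaves≤innerDegrees = begin
    #leaves
      ≡⟨ ∑ᵥ-cong leafDegree ⟩
    ∑ᵥ (λ u → (𝟙 (V u) * 𝟙 (leaf u)) * deg u)
      ≡⟨ ∑ᵥ-cong (λ u → sym (∑ᵥ-*ˡ (𝟙 (V u) * 𝟙 (leaf u)) (M u))) ⟩
    ∑ᵥ (λ u → ∑ᵥ (λ a → (𝟙 (V u) * 𝟙 (leaf u)) * M u a))
      ≡⟨ ∑ᵥ-comm _ ⟩
    ∑ᵥ (λ a → ∑ᵥ (λ u → (𝟙 (V u) * 𝟙 (leaf u)) * M u a))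
      ≤⟨ ∑ᵥ-mono-≤ (λ a → ∑ᵥ-mono-≤ (leafEdge a)) ⟩
    ∑ᵥ (λ a → ∑ᵥ (λ u → (𝟙 (V a) * 𝟙 (not (leaf a))) * M a u))
      ≡⟨ ∑ᵥ-cong (λ a → trans (∑ᵥ-*ˡ (𝟙 (V a) * 𝟙 (not (leaf a))) (M a)) (*-assoc (𝟙 (V a)) _ _)) ⟩
    innerDegrees ∎
    where
    open ≤-Reasoning
    leafDegree : ∀ u → 𝟙 (V u) * 𝟙 (leaf u) ≡ (𝟙 (V u) * 𝟙 (leaf u)) * deg u
    leafDegree u with leaf u in isLeaf
    ... | false = trans (*-zeroʳ (𝟙 (V u))) (sym (cong (_* deg u) (*-zeroʳ (𝟙 (V u)))))
    ... | true  = trans (sym (*-identityʳ _)) (cong ((𝟙 (V u) * 1) *_) (sym (≡ᵇ-true⇒≡ isLeaf)))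
    leafEdge : ∀ a u → (𝟙 (V u) * 𝟙 (leaf u)) * M u a ≤ (𝟙 (V a) * 𝟙 (not (leaf a))) * M a u
    leafEdge a u with V u in Vu | leaf u in uLeaf | M u a in Mua | M≤1 u a
    ... | false | _     | _     | _ = z≤n
    ... | true  | false | _     | _ = z≤n
    ... | true  | true  | zero  | _ = z≤n
    ... | true  | true  | suc zero | _ with M-closed u a Vu Mua
    ...   | Va rewrite Va with leaf a in aLeaf
    ...     | true  = ⊥-elim (no-leaf-edge a u Va (trans (M-sym a u Va Vu) Mua) (≡ᵇ-true⇒≡ aLeaf) (≡ᵇ-true⇒≡ uLeaf))
    ...     | false = ≤-reflexive (sym (trans (+-identityʳ _) (trans (M-sym a u Va Vu) Mua)))
    leafEdge a u | true | true | suc (suc _) | s≤s ()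

  4∣V∣≤3∑deg : 4 * ∑ᵥ (λ a → 𝟙 (V a)) ≤ 3 * ∑ᵥ (λ a → 𝟙 (V a) * deg a)
  4∣V∣≤3∑deg rewrite ∣V∣≡#leaves+#inner | ∑deg≡#leaves+innerDegrees =
    combine #leaves #inner innerDegrees 2*#inner≤innerDegrees #leaves≤innerDegrees
    where
    combine : ∀ a b d → 2 * b ≤ d → a ≤ d → 4 * (a + b) ≤ 3 * (a + d)
    combine a b d 2b≤d a≤d = subst₂ _≤_ (lhs a b) (rhs a d) (+-mono-≤ (+-monoʳ-≤ (3 * a) a≤d) (*-monoʳ-≤ 2 2b≤d))
      where
      lhs : ∀ a b → 3 * a + a + 2 * (2 * b) ≡ 4 * (a + b)
      lhs = solve-∀
      rhs : ∀ a d → 3 * a + d + 2 * d ≡ 3 * (a + d)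
      rhs = solve-∀

⌈2[r+1]/3⌉ : ℕ → ℕ
⌈2[r+1]/3⌉ r = (2 * (r + 1) + 2) / 3

2[r+1]≤3⌈2[r+1]/3⌉ : ∀ r → 2 * (r + 1) ≤ 3 * ⌈2[r+1]/3⌉ r
2[r+1]≤3⌈2[r+1]/3⌉ r = +-cancelʳ-≤ 2 _ _ (begin
  2 * (r + 1) + 2                              ≡⟨ m≡m%n+[m/n]*n (2 * (r + 1) + 2) 3 ⟩
  (2 * (r + 1) + 2) % 3 + ⌈2[r+1]/3⌉ r * 3     ≤⟨ +-monoˡ-≤ _ (s≤s⁻¹ (m%n<n (2 * (r + 1) + 2) 3)) ⟩
  2 + ⌈2[r+1]/3⌉ r * 3                         ≡⟨ +-comm 2 _ ⟩
  ⌈2[r+1]/3⌉ r * 3 + 2                         ≡⟨ cong (_+ 2) (*-comm (⌈2[r+1]/3⌉ r) 3) ⟩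
  3 * ⌈2[r+1]/3⌉ r + 2                         ∎)
  where open ≤-Reasoning

2⌈2[r+1]/3⌉≤[r+1]r : ∀ r → 2 ≤ r → 2 * ⌈2[r+1]/3⌉ r ≤ (r + 1) * r
2⌈2[r+1]/3⌉≤[r+1]r (suc zero) (s≤s ())
2⌈2[r+1]/3⌉≤[r+1]r (suc (suc s)) _ = *-cancelˡ-≤ 3 (begin
  3 * (2 * K)                                       ≡⟨ regroup K ⟩
  2 * (K * 3)                                       ≤⟨ *-monoʳ-≤ 2 (m/n*n≤m (2 * (r + 1) + 2) 3) ⟩
  2 * (2 * (r + 1) + 2)                             ≤⟨ m≤m+n _ (3 * s * s + 11 * s + 2) ⟩
  2 * (2 * (r + 1) + 2) + (3 * s * s + 11 * s + 2)  ≡⟨ expand s ⟩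
  3 * ((r + 1) * r)                                 ∎)
  where
  open ≤-Reasoning
  r = suc (suc s)
  K = ⌈2[r+1]/3⌉ r
  regroup : ∀ K → 3 * (2 * K) ≡ 2 * (K * 3)
  regroup = solve-∀
  expand : ∀ s → 2 * (2 * (suc (suc s) + 1) + 2) + (3 * s * s + 11 * s + 2) ≡ 3 * ((suc (suc s) + 1) * suc (suc s))
  expand = solve-∀

triangle : ℕ → ℕ
triangle zero    = 0
triangle (suc m) = suc m + triangle m

2*triangle : ∀ r → 2 * triangle r ≡ (r + 1) * r
2*triangle zero    = refl
2*triangle (suc m) = trans (*-distribˡ-+ 2 (suc m) (triangle m)) (trans (cong (2 * suc m +_) (2*triangle m)) (step m))
  where
  step : ∀ m → 2 * suc m + (m + 1) * m ≡ (suc m + 1) * suc m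
  step = solve-∀

-- (r+1)r is even, which is what lets the floor of a sixth absorb the factor 2.
[r+1]r∸2K≤2P : ∀ r → (r + 1) * r ∸ 2 * ⌈2[r+1]/3⌉ r ≤ 2 * (((r + 1) * (3 * r ∸ 4)) / 6)
[r+1]r∸2K≤2P r = begin
  (r + 1) * r ∸ 2 * K    ≡⟨ cong (_∸ 2 * K) (sym (2*triangle r)) ⟩
  2 * triangle r ∸ 2 * K ≡⟨ sym (*-distribˡ-∸ 2 (triangle r) K) ⟩
  2 * (triangle r ∸ K)   ≤⟨ *-monoʳ-≤ 2 (subst (_≤ ((r + 1) * (3 * r ∸ 4)) / 6) (m*n/n≡m (triangle r ∸ K) 6)
                                          (/-monoˡ-≤ 6 (subst (_≤ (r + 1) * (3 * r ∸ 4)) (*-comm 6 (triangle r ∸ K)) six))) ⟩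
  2 * (((r + 1) * (3 * r ∸ 4)) / 6) ∎
  where
  open ≤-Reasoning
  K : ℕ
  K = ⌈2[r+1]/3⌉ r
  six : 6 * (triangle r ∸ K) ≤ (r + 1) * (3 * r ∸ 4)
  six = begin
    6 * (triangle r ∸ K)                ≡⟨ *-distribˡ-∸ 6 (triangle r) K ⟩
    6 * triangle r ∸ 6 * K
      ≤⟨ ∸-monoʳ-≤ (6 * triangle r) (subst₂ _≤_ (four r) (six* K) (*-monoʳ-≤ 2 (2[r+1]≤3⌈2[r+1]/3⌉ r))) ⟩
    6 * triangle r ∸ (r + 1) * 4
      ≡⟨ cong (_∸ (r + 1) * 4) (trans (sym (regroup (triangle r))) (trans (cong (3 *_) (2*triangle r)) (three r))) ⟩
    (r + 1) * (3 * r) ∸ (r + 1) * 4     ≡⟨ sym (*-distribˡ-∸ (r + 1) (3 * r) 4) ⟩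
    (r + 1) * (3 * r ∸ 4)               ∎
    where
    four : ∀ r → 2 * (2 * (r + 1)) ≡ (r + 1) * 4
    four = solve-∀
    six* : ∀ K → 2 * (3 * K) ≡ 6 * K
    six* = solve-∀
    three : ∀ r → 3 * ((r + 1) * r) ≡ (r + 1) * (3 * r)
    three = solve-∀
    regroup : ∀ t → 3 * (2 * t) ≡ 6 * t
    regroup = solve-∀

-- Friendship hypergraphs

module FriendshipHypergraph {k n : ℕ} (H : Hypergraph (suc (suc k)) n) (friendship : IsFriendship H) where

  r : ℕ
  r = suc (suc k)

  E D : Subset n → Bool
  E = edge H
  D = decompEdge H

  D-size : ∀ {S} → D S ≡ true → ∣ S ∣ ≡ suc r
  D-size {S} isBlock = ≡ᵇ-true⇒≡ (proj₁ (∧-true⁻ {∣ S ∣ ≡ᵇ suc r} isBlock))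

  D⇒edge : ∀ {S T} → D S ≡ true → T ⊆ S → ∣ T ∣ ≡ r → E T ≡ true
  D⇒edge {S} {T} isBlock T⊆S ∣T∣ =
    subFaces (allᵇ-allSubsets⁻ _ (proj₂ (∧-true⁻ {∣ S ∣ ≡ᵇ suc r} isBlock)) T)
    where
    subFaces : (not (does (T ⊆? S) ∧ (∣ T ∣ ≡ᵇ r)) ∨ E T) ≡ true → E T ≡ true
    subFaces h rewrite does-⊆?≡⊆ᵇ T S | ⊆⇒⊆ᵇ T⊆S | ∣T∣ | ≡⇒≡ᵇ-true {r} refl = h

  D-intro : ∀ {S} → ∣ S ∣ ≡ suc r → (∀ T → T ⊆ S → ∣ T ∣ ≡ r → E T ≡ true) → D S ≡ true
  D-intro {S} ∣S∣ allFaces rewrite ∣S∣ | ≡⇒≡ᵇ-true {suc r} refl = allᵇ-allSubsets⁺ _ face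
    where
    face : ∀ T → (not (does (T ⊆? S) ∧ (∣ T ∣ ≡ᵇ r)) ∨ E T) ≡ true
    face T rewrite does-⊆?≡⊆ᵇ T S with T ⊆ᵇ S in T⊆S | ∣ T ∣ ≡ᵇ r in ∣T∣
    ... | false | _     = refl
    ... | true  | false = refl
    ... | true  | true  = allFaces T (⊆ᵇ⇒⊆ T⊆S) (≡ᵇ-true⇒≡ ∣T∣)

  friend-unique : ∀ {A u v} → ∣ A ∣ ≡ r → Friend H u A → Friend H v A → u ≡ v
  friend-unique {A} ∣A∣ u-friend v-friend with friendship A ∣A∣
  ... | w , _ , only-w = trans (only-w _ u-friend) (sym (only-w _ v-friend))

  D⇒friend : ∀ {S T w} → D S ≡ true → T ⊆ S → ∣ T ∣ ≡ r → lookup S w ≡ true → lookup T w ≡ false → Friend H w T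
  D⇒friend {S} {T} {w} isBlock T⊆S ∣T∣ Sw Tw = lookup⇒∉ Tw , λ B B⊆T ∣B∣ →
    D⇒edge isBlock (p∪⁅x⁆⊆q (⊆-trans B⊆T T⊆S) Sw) (trans (∣p∪⁅x⁆∣≡1+∣p∣ B w (⊆⇒lookup-false B⊆T Tw)) (cong suc ∣B∣))

  -- The block through an edge T is T together with the friend of T.
  #blocks⊇edge : ∀ T → ∣ T ∣ ≡ r → ∑ₛ (λ S → 𝟙 (D S) * 𝟙 (T ⊆ᵇ S)) ≡ 𝟙 (E T)
  #blocks⊇edge T ∣T∣ with E T in ET
  ... | false = ∑ₛ-zero λ S → 𝟙*𝟙≡0 (D S) (T ⊆ᵇ S) λ isBlock T⊆S →
                  true≢false (trans (sym (D⇒edge isBlock (⊆ᵇ⇒⊆ T⊆S) ∣T∣)) ET)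
  ... | true with friendship T ∣T∣
  ...   | u , (u∉T , u-friend) , only-u =
    trans (∑ₛ-single _ (T ∪ ⁅ u ⁆) others) (cong₂ (λ a b → 𝟙 a * 𝟙 b) T∪u-block (⊆⇒⊆ᵇ (p⊆p∪⁅x⁆ T u)))
    where
    Tu : lookup T u ≡ false
    Tu = ∉⇒lookup u∉T
    face : ∀ T′ → T′ ⊆ T ∪ ⁅ u ⁆ → ∣ T′ ∣ ≡ r → E T′ ≡ true
    face T′ T′⊆ ∣T′∣ with lookup T′ u in T′u
    ... | false = subst (λ X → E X ≡ true)
                    (sym (⊆∧∣q∣≤∣p∣⇒≡ (⊆-trans (x∉q⇒q⊆q-x T′u) (q⊆p∪⁅x⁆⇒q-x⊆p T′⊆)) (≤-reflexive (trans ∣T∣ (sym ∣T′∣))))) ET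
    ... | true  = subst (λ X → E X ≡ true) (p-x∪⁅x⁆≡p T′ u T′u)
                    (u-friend (T′ - u) (q⊆p∪⁅x⁆⇒q-x⊆p T′⊆) (suc-injective (trans (sym (∣p∣≡1+∣p-x∣ T′ u T′u)) ∣T′∣)))
    T∪u-block : D (T ∪ ⁅ u ⁆) ≡ true
    T∪u-block = D-intro (trans (∣p∪⁅x⁆∣≡1+∣p∣ T u Tu) (cong suc ∣T∣)) face
    others : ∀ S → S ≢ T ∪ ⁅ u ⁆ → 𝟙 (D S) * 𝟙 (T ⊆ᵇ S) ≡ 0
    others S S≢ = 𝟙*𝟙≡0 (D S) (T ⊆ᵇ S) λ isBlock T⊆S → S≢ (extension isBlock (⊆ᵇ⇒⊆ T⊆S))
      where
      extension : D S ≡ true → T ⊆ S → S ≡ T ∪ ⁅ u ⁆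
      extension isBlock T⊆S with ⊆∧1+∣p∣≡∣q∣⇒q≡p∪⁅x⁆ T⊆S (trans (cong suc ∣T∣) (sym (D-size isBlock)))
      ... | w , Sw , Tw , S≡T∪w = trans S≡T∪w (cong (λ z → T ∪ ⁅ z ⁆) (only-u w (D⇒friend isBlock T⊆S ∣T∣ Sw Tw)))

  deg : Subset n → ℕ
  deg Y = ∑ᵥ (λ v → 𝟙 (not (lookup Y v)) * 𝟙 (E (Y ∪ ⁅ v ⁆)))

  #blocks⊇ : Subset n → ℕ
  #blocks⊇ Y = ∑ₛ (λ S → 𝟙 (D S) * 𝟙 (Y ⊆ᵇ S))

  -- Every edge Y ∪ {v} lies in exactly one block, and a block through Y contains exactly two of them.
  deg≡2*#blocks⊇ : ∀ Y → ∣ Y ∣ ≡ suc k → deg Y ≡ 2 * #blocks⊇ Y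
  deg≡2*#blocks⊇ Y ∣Y∣ = begin
    deg Y
      ≡⟨ ∑ᵥ-cong edgeAsBlocks ⟩
    ∑ᵥ (λ v → 𝟙 (not (lookup Y v)) * ∑ₛ (λ S → 𝟙 (D S) * 𝟙 ((Y ∪ ⁅ v ⁆) ⊆ᵇ S)))
      ≡⟨ ∑ᵥ-cong (λ v → sym (∑ₛ-*ˡ (𝟙 (not (lookup Y v))) _)) ⟩
    ∑ᵥ (λ v → ∑ₛ (λ S → 𝟙 (not (lookup Y v)) * (𝟙 (D S) * 𝟙 ((Y ∪ ⁅ v ⁆) ⊆ᵇ S))))
      ≡⟨ ∑ᵥ∑ₛ-comm _ ⟩
    ∑ₛ (λ S → ∑ᵥ (λ v → 𝟙 (not (lookup Y v)) * (𝟙 (D S) * 𝟙 ((Y ∪ ⁅ v ⁆) ⊆ᵇ S))))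
      ≡⟨ ∑ₛ-cong twoEdges ⟩
    ∑ₛ (λ S → 2 * (𝟙 (D S) * 𝟙 (Y ⊆ᵇ S)))
      ≡⟨ ∑ₛ-*ˡ 2 _ ⟩
    2 * #blocks⊇ Y ∎
    where
    open ≡-Reasoning
    edgeAsBlocks : ∀ v → 𝟙 (not (lookup Y v)) * 𝟙 (E (Y ∪ ⁅ v ⁆))
                       ≡ 𝟙 (not (lookup Y v)) * ∑ₛ (λ S → 𝟙 (D S) * 𝟙 ((Y ∪ ⁅ v ⁆) ⊆ᵇ S))
    edgeAsBlocks v with lookup Y v in Yv
    ... | true  = refl
    ... | false = cong (1 *_) (sym (#blocks⊇edge (Y ∪ ⁅ v ⁆) (trans (∣p∪⁅x⁆∣≡1+∣p∣ Y v Yv) (cong suc ∣Y∣))))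
    twoEdges : ∀ S → ∑ᵥ (λ v → 𝟙 (not (lookup Y v)) * (𝟙 (D S) * 𝟙 ((Y ∪ ⁅ v ⁆) ⊆ᵇ S)))
                   ≡ 2 * (𝟙 (D S) * 𝟙 (Y ⊆ᵇ S))
    twoEdges S = trans (∑ᵥ-cong λ v → cong (λ b → 𝟙 (not (lookup Y v)) * (𝟙 (D S) * 𝟙 b)) (⊆ᵇ-p∪⁅x⁆ Y S v))
                       (cases (D S) refl (Y ⊆ᵇ S) refl)
      where
      cases : ∀ a → D S ≡ a → ∀ b → (Y ⊆ᵇ S) ≡ b →
        ∑ᵥ (λ v → 𝟙 (not (lookup Y v)) * (𝟙 a * 𝟙 (b ∧ lookup S v))) ≡ 2 * (𝟙 a * 𝟙 b)
      cases false _ _ _ = ∑ᵥ-zero λ v → *-zeroʳ (𝟙 (not (lookup Y v)))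
      cases true  _ false _ = ∑ᵥ-zero λ v → *-zeroʳ (𝟙 (not (lookup Y v)))
      cases true  isBlock true Y⊆S = begin
        ∑ᵥ (λ v → 𝟙 (not (lookup Y v)) * (1 * 𝟙 (lookup S v)))
          ≡⟨ ∑ᵥ-cong (λ v → trans (cong (𝟙 (not (lookup Y v)) *_) (+-identityʳ _))
                                  (trans (*-comm (𝟙 (not (lookup Y v))) _) (sym (𝟙-∧ (lookup S v) (not (lookup Y v)))))) ⟩
        ∑ᵥ (λ v → 𝟙 (lookup S v ∧ not (lookup Y v)))
          ≡⟨ ⊆∧∣q∣≡m+∣p∣⇒∣q∖p∣≡m 2 (⊆ᵇ⇒⊆ Y⊆S) (trans (D-size isBlock) (cong (2 +_) (sym ∣Y∣))) ⟩
        2 ∎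

  ∑deg*w≡∑blocks∑pairs : ∀ (w : Subset n → ℕ) →
    ∑ₛ (λ Y → 𝟙 (∣ Y ∣ ≡ᵇ suc k) * (deg Y * w Y)) ≡ ∑ₛ (λ S → 𝟙 (D S) * ∑pairs S w)
  ∑deg*w≡∑blocks∑pairs w = begin
    ∑ₛ (λ Y → 𝟙 (∣ Y ∣ ≡ᵇ suc k) * (deg Y * w Y))
      ≡⟨ ∑ₛ-cong overBlocks ⟩
    ∑ₛ (λ Y → ∑ₛ (λ S → 𝟙 (D S) * (𝟙 (Y ⊆ᵇ S) * (𝟙 (∣ Y ∣ ≡ᵇ suc k) * (2 * w Y)))))
      ≡⟨ ∑ₛ-comm _ ⟩
    ∑ₛ (λ S → ∑ₛ (λ Y → 𝟙 (D S) * (𝟙 (Y ⊆ᵇ S) * (𝟙 (∣ Y ∣ ≡ᵇ suc k) * (2 * w Y)))))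
      ≡⟨ ∑ₛ-cong asPairs ⟩
    ∑ₛ (λ S → 𝟙 (D S) * ∑pairs S w) ∎
    where
    open ≡-Reasoning
    overBlocks : ∀ Y → 𝟙 (∣ Y ∣ ≡ᵇ suc k) * (deg Y * w Y)
                     ≡ ∑ₛ (λ S → 𝟙 (D S) * (𝟙 (Y ⊆ᵇ S) * (𝟙 (∣ Y ∣ ≡ᵇ suc k) * (2 * w Y))))
    overBlocks Y with ∣ Y ∣ ≡ᵇ suc k in ∣Y∣
    ... | false = sym (∑ₛ-zero λ S → trans (cong (𝟙 (D S) *_) (*-zeroʳ (𝟙 (Y ⊆ᵇ S)))) (*-zeroʳ (𝟙 (D S))))
    ... | true  = begin
      1 * (deg Y * w Y)                                       ≡⟨ +-identityʳ _ ⟩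
      deg Y * w Y                                             ≡⟨ cong (_* w Y) (deg≡2*#blocks⊇ Y (≡ᵇ-true⇒≡ ∣Y∣)) ⟩
      2 * #blocks⊇ Y * w Y                                    ≡⟨ regroup (#blocks⊇ Y) (w Y) ⟩
      #blocks⊇ Y * (2 * w Y)                                  ≡⟨ sym (∑ₛ-*ʳ (2 * w Y) _) ⟩
      ∑ₛ (λ S → 𝟙 (D S) * 𝟙 (Y ⊆ᵇ S) * (2 * w Y))             ≡⟨ ∑ₛ-cong (λ S → reassoc (𝟙 (D S)) (𝟙 (Y ⊆ᵇ S)) (2 * w Y)) ⟩
      ∑ₛ (λ S → 𝟙 (D S) * (𝟙 (Y ⊆ᵇ S) * (1 * (2 * w Y))))     ∎
      where
      regroup : ∀ b w → 2 * b * w ≡ b * (2 * w)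
      regroup = solve-∀
      reassoc : ∀ a b c → a * b * c ≡ a * (b * (1 * c))
      reassoc = solve-∀
    asPairs : ∀ S → ∑ₛ (λ Y → 𝟙 (D S) * (𝟙 (Y ⊆ᵇ S) * (𝟙 (∣ Y ∣ ≡ᵇ suc k) * (2 * w Y))))
                  ≡ 𝟙 (D S) * ∑pairs S w
    asPairs S with D S in isBlock
    ... | false = ∑ₛ-zero λ _ → refl
    ... | true  = begin
      ∑ₛ (λ Y → 1 * (𝟙 (Y ⊆ᵇ S) * (𝟙 (∣ Y ∣ ≡ᵇ suc k) * (2 * w Y))))
        ≡⟨ ∑ₛ-cong (λ Y → regroup (𝟙 (Y ⊆ᵇ S)) (𝟙 (∣ Y ∣ ≡ᵇ suc k)) (w Y)) ⟩
      ∑ₛ (λ Y → 2 * (𝟙 (Y ⊆ᵇ S) * (𝟙 (∣ Y ∣ ≡ᵇ suc k) * w Y)))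
        ≡⟨ ∑ₛ-*ˡ 2 _ ⟩
      2 * ∑ₛ (λ Y → 𝟙 (Y ⊆ᵇ S) * (𝟙 (∣ Y ∣ ≡ᵇ suc k) * w Y))
        ≡⟨ sym (∑pairs≡2∑ S (suc k) w (D-size isBlock)) ⟩
      ∑pairs S w
        ≡⟨ sym (+-identityʳ _) ⟩
      1 * ∑pairs S w ∎
      where
      regroup : ∀ a b w → 1 * (a * (b * (2 * w))) ≡ 2 * (a * (b * w))
      regroup = solve-∀

  friend-via-removals : ∀ {X u} → ∣ X ∣ ≡ r → lookup X u ≡ false →
    (∀ z → lookup X z ≡ true → E ((X - z) ∪ ⁅ u ⁆) ≡ true) → Friend H u X
  friend-via-removals {X} {u} ∣X∣ Xu removals = lookup⇒∉ Xu , λ B B⊆X ∣B∣ →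
    asRemoval B (⊆∧1+∣p∣≡∣q∣⇒≡-x B⊆X (trans (cong suc ∣B∣) (sym ∣X∣)))
    where
    asRemoval : ∀ B → (Σ (Fin n) λ z → lookup X z ≡ true × lookup B z ≡ false × B ≡ X - z) → E (B ∪ ⁅ u ⁆) ≡ true
    asRemoval B (z , Xz , _ , B≡X-z) = subst (λ Z → E (Z ∪ ⁅ u ⁆) ≡ true) (sym B≡X-z) (removals z Xz)

  module OutsideVertex {S : Subset n} {y : Fin n} (isBlock : D S ≡ true) (Sy : lookup S y ≡ false) where

    M : Fin n → Fin n → ℕ
    M a b = 𝟙 (lookup (S - a) b) * 𝟙 (not (E ((S - a - b) ∪ ⁅ y ⁆)))

    M≤1 : ∀ a b → M a b ≤ 1
    M≤1 a b with lookup (S - a) b | E ((S - a - b) ∪ ⁅ y ⁆)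
    ... | true  | true  = z≤n
    ... | true  | false = s≤s z≤n
    ... | false | _     = z≤n

    S-a∋b⇒S∋b : ∀ {a b} → lookup (S - a) b ≡ true → lookup S b ≡ true
    S-a∋b⇒S∋b {a} {b} = ⊆⇒lookup (p-x⊆p S a) b

    M-closed : ∀ a b → lookup S a ≡ true → M a b ≡ 1 → lookup S b ≡ true
    M-closed a b _ Mab = S-a∋b⇒S∋b (proj₁ (𝟙*𝟙≡1⁻ Mab))

    M-sym : ∀ a b → lookup S a ≡ true → lookup S b ≡ true → M a b ≡ M b a
    M-sym a b Sa Sb = cong₂ (λ u w → 𝟙 u * 𝟙 (not (E (w ∪ ⁅ y ⁆))))
      (trans (lookup[p-x] S a b) (trans (cong₂ (λ p q → p ∧ not q) Sb (==-sym b a))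
                                     (sym (trans (lookup[p-x] S b a) (cong (λ p → p ∧ not (a == b)) Sa)))))
      (p─x─y≡p─y─x S a b)

    ∣S-a∣ : ∀ {a} → lookup S a ≡ true → ∣ S - a ∣ ≡ r
    ∣S-a∣ {a} Sa = suc-injective (trans (sym (∣p∣≡1+∣p-x∣ S a Sa)) (D-size isBlock))

    ∣S-a-b∣ : ∀ {a b} → lookup S a ≡ true → lookup (S - a) b ≡ true → ∣ S - a - b ∣ ≡ suc k
    ∣S-a-b∣ {a} {b} Sa Sab = suc-injective (trans (sym (∣p∣≡1+∣p-x∣ (S - a) b Sab)) (∣S-a∣ Sa))

    [S-a-b]y : ∀ a b → lookup (S - a - b) y ≡ false
    [S-a-b]y a b = ⊆⇒lookup-false (⊆-trans (p-x⊆p (S - a) b) (p-x⊆p S a)) Sy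

    ∣[S-a-b]∪y∣ : ∀ {a b} → lookup S a ≡ true → lookup (S - a) b ≡ true → ∣ (S - a - b) ∪ ⁅ y ⁆ ∣ ≡ r
    ∣[S-a-b]∪y∣ {a} {b} Sa Sab = trans (∣p∪⁅x⁆∣≡1+∣p∣ (S - a - b) y ([S-a-b]y a b)) (cong suc (∣S-a-b∣ Sa Sab))

    ∈S⇒≢y : ∀ {a} → lookup S a ≡ true → a ≢ y
    ∈S⇒≢y Sa = lookup-true-false⇒≢ S Sa Sy

    δ : Fin n → ℕ
    δ a = ∑ᵥ (M a)

    -- An isolated a would make y a second friend of S - a, next to a itself.
    no-isolated : ∀ a → lookup S a ≡ true → 1 ≤ δ a
    no-isolated a Sa with δ a in δ≡
    ... | suc _ = s≤s z≤n
    ... | zero  = ⊥-elim (∈S⇒≢y Sa (friend-unique (∣S-a∣ Sa) a-friend y-friend))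
      where
      a-friend : Friend H a (S - a)
      a-friend = D⇒friend isBlock (p-x⊆p S a) (∣S-a∣ Sa) Sa (lookup[p-x]x≡false S a)
      y-friend : Friend H y (S - a)
      y-friend = friend-via-removals (∣S-a∣ Sa) (⊆⇒lookup-false (p-x⊆p S a) Sy) λ b Sab →
        not-injective (𝟙*𝟙≡0⁻ (n≤0⇒n≡0 (subst (M a b ≤_) δ≡ (∑ᵥ-≤ (M a) b))) Sab)

    only-neighbour⇒friend : ∀ a b → lookup S a ≡ true → lookup (S - a) b ≡ true →
      (∀ c → c ≢ a → lookup (S - b) c ≡ true → E ((S - b - c) ∪ ⁅ y ⁆) ≡ true) →
      Friend H a ((S - a - b) ∪ ⁅ y ⁆)
    only-neighbour⇒friend a b Sa Sab others = friend-via-removals (∣[S-a-b]∪y∣ Sa Sab) a∉X removal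
      where
      X : Subset n
      X = (S - a - b) ∪ ⁅ y ⁆
      b≢a : b ≢ a
      b≢a = lookup[p-x]y⇒y≢x S Sab
      a≢b : a ≢ b
      a≢b a≡b = b≢a (sym a≡b)
      Sb : lookup S b ≡ true
      Sb = S-a∋b⇒S∋b Sab
      a∉X : lookup X a ≡ false
      a∉X = trans (lookup-∪⁅⁆ (S - a - b) y a)
                  (cong₂ _∨_ (⊆⇒lookup-false (p-x⊆p (S - a) b) (lookup[p-x]x≡false S a)) (≢⇒==-false (∈S⇒≢y Sa)))
      S-a-b≡S-b-a : S - a - b ≡ S - b - a
      S-a-b≡S-b-a = p─x─y≡p─y─x S a b
      removal : ∀ z → lookup X z ≡ true → E ((X - z) ∪ ⁅ a ⁆) ≡ true
      removal z Xz with z ≟ᶠ y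
      ... | yes refl = subst (λ Z → E Z ≡ true) (sym (begin
            (((S - a - b) ∪ ⁅ y ⁆) - y) ∪ ⁅ a ⁆  ≡⟨ cong (_∪ ⁅ a ⁆) (p∪⁅x⁆-x≡p (S - a - b) y ([S-a-b]y a b)) ⟩
            (S - a - b) ∪ ⁅ a ⁆                ≡⟨ cong (_∪ ⁅ a ⁆) S-a-b≡S-b-a ⟩
            (S - b - a) ∪ ⁅ a ⁆                ≡⟨ p-x∪⁅x⁆≡p (S - b) a (lookup[p-y]x≡true S Sa a≢b) ⟩
            S - b                              ∎))
          (D⇒edge isBlock (p-x⊆p S b) (∣S-a∣ Sb))
        where open ≡-Reasoning
      ... | no z≢y = subst (λ Z → E Z ≡ true) (sym (begin
            (((S - a - b) ∪ ⁅ y ⁆) - z) ∪ ⁅ a ⁆  ≡⟨ cong (_∪ ⁅ a ⁆) ([p∪⁅x⁆]-y≡[p-y]∪⁅x⁆ (S - a - b) (λ y≡z → z≢y (sym y≡z))) ⟩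
            ((S - a - b - z) ∪ ⁅ y ⁆) ∪ ⁅ a ⁆    ≡⟨ p∪⁅x⁆∪⁅y⁆≡p∪⁅y⁆∪⁅x⁆ (S - a - b - z) y a ⟩
            ((S - a - b - z) ∪ ⁅ a ⁆) ∪ ⁅ y ⁆    ≡⟨ cong (λ Z → (Z ∪ ⁅ a ⁆) ∪ ⁅ y ⁆) reorder ⟩
            ((S - b - z - a) ∪ ⁅ a ⁆) ∪ ⁅ y ⁆    ≡⟨ cong (_∪ ⁅ y ⁆) (p-x∪⁅x⁆≡p (S - b - z) a [S-b-z]a) ⟩
            (S - b - z) ∪ ⁅ y ⁆                  ∎))
          (others z (λ z≡a → a≢z (sym z≡a)) (lookup[p-y]x≡true S Sz z≢b))
        where
        open ≡-Reasoning
        [S-a-b]z : lookup (S - a - b) z ≡ true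
        [S-a-b]z = trans (sym (∨-identityʳ _)) (trans (cong (lookup (S - a - b) z ∨_) (sym (≢⇒==-false z≢y)))
                                                      (trans (sym (lookup-∪⁅⁆ (S - a - b) y z)) Xz))
        [S-a]z : lookup (S - a) z ≡ true
        [S-a]z = ⊆⇒lookup (p-x⊆p (S - a) b) z [S-a-b]z
        Sz : lookup S z ≡ true
        Sz = S-a∋b⇒S∋b [S-a]z
        z≢b : z ≢ b
        z≢b = lookup[p-x]y⇒y≢x (S - a) [S-a-b]z
        a≢z : a ≢ z
        a≢z a≡z = lookup[p-x]y⇒y≢x S [S-a]z (sym a≡z)
        reorder : S - a - b - z ≡ S - b - z - a
        reorder = trans (cong (_- z) S-a-b≡S-b-a) (p─x─y≡p─y─x (S - b) a z)
        [S-b-z]a : lookup (S - b - z) a ≡ true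
        [S-b-z]a = lookup[p-y]x≡true (S - b) (lookup[p-y]x≡true S Sa a≢b) a≢z

    no-leaf-edge : ∀ a b → lookup S a ≡ true → M a b ≡ 1 → δ a ≡ 1 → δ b ≡ 1 → ⊥
    no-leaf-edge a b Sa Mab δa≡1 δb≡1 = b≢a (sym (friend-unique (∣[S-a-b]∪y∣ Sa Sab) a-friend b-friend))
      where
      Sab : lookup (S - a) b ≡ true
      Sab = proj₁ (𝟙*𝟙≡1⁻ {lookup (S - a) b} Mab)
      Sb : lookup S b ≡ true
      Sb = S-a∋b⇒S∋b Sab
      b≢a : b ≢ a
      b≢a = lookup[p-x]y⇒y≢x S Sab
      Mba : M b a ≡ 1
      Mba = trans (sym (M-sym a b Sa Sb)) Mab
      Sba : lookup (S - b) a ≡ true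
      Sba = proj₁ (𝟙*𝟙≡1⁻ {lookup (S - b) a} Mba)
      only-neighbour : ∀ {u v} → M u v ≡ 1 → δ u ≡ 1 →
        ∀ c → c ≢ v → lookup (S - u) c ≡ true → E ((S - u - c) ∪ ⁅ y ⁆) ≡ true
      only-neighbour {u} Muv δu≡1 c c≢v Suc =
        not-injective (𝟙*𝟙≡0⁻ (∑ᵥf≤f[b]⇒f[c]≡0 (M u) (≤-reflexive (trans δu≡1 (sym Muv))) c≢v) Suc)
      a-friend : Friend H a ((S - a - b) ∪ ⁅ y ⁆)
      a-friend = only-neighbour⇒friend a b Sa Sab (only-neighbour Mba δb≡1)
      b-friend : Friend H b ((S - a - b) ∪ ⁅ y ⁆)
      b-friend = subst (λ Z → Friend H b (Z ∪ ⁅ y ⁆)) (p─x─y≡p─y─x S b a)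
                       (only-neighbour⇒friend b a Sb Sba (only-neighbour Mab δa≡1))

    #non-edges : ℕ
    #non-edges = ∑pairs S (λ Y → 𝟙 (not (E (Y ∪ ⁅ y ⁆))))

    2⌈2[r+1]/3⌉≤#non-edges : 2 * ⌈2[r+1]/3⌉ r ≤ #non-edges
    2⌈2[r+1]/3⌉≤#non-edges = subst (2 * ⌈2[r+1]/3⌉ r ≤_) (sym #non-edges≡2t)
                                  (*-monoʳ-≤ 2 (2m≤3t⇒[2m+2]/3≤t (r + 1) t 2[r+1]≤3t))
      where
      open DegreeBound (lookup S) M M≤1 M-closed M-sym no-isolated no-leaf-edge using (4∣V∣≤3∑deg)
      t : ℕ
      t = ∑ₛ (λ Y → 𝟙 (Y ⊆ᵇ S) * (𝟙 (∣ Y ∣ ≡ᵇ suc k) * 𝟙 (not (E (Y ∪ ⁅ y ⁆)))))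
      #non-edges≡2t : #non-edges ≡ 2 * t
      #non-edges≡2t = ∑pairs≡2∑ S (suc k) _ (D-size isBlock)
      ∑δ≡#non-edges : ∑ᵥ (λ a → 𝟙 (lookup S a) * δ a) ≡ #non-edges
      ∑δ≡#non-edges = ∑ᵥ-cong λ a → sym (∑ᵥ-*ˡ (𝟙 (lookup S a)) (M a))
      4[r+1]≤3[2t] : 4 * (r + 1) ≤ 3 * (2 * t)
      4[r+1]≤3[2t] = subst₂ (λ u v → 4 * u ≤ 3 * v)
                       (trans (sym (∣p∣≡∑ S)) (trans (D-size isBlock) (+-comm 1 r)))
                       (trans ∑δ≡#non-edges #non-edges≡2t) 4∣V∣≤3∑deg
      2[r+1]≤3t : 2 * (r + 1) ≤ 3 * t
      2[r+1]≤3t = *-cancelˡ-≤ 2 (subst₂ _≤_ (double r) (swap t) 4[r+1]≤3[2t])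
        where
        double : ∀ r → 4 * (r + 1) ≡ 2 * (2 * (r + 1))
        double = solve-∀
        swap : ∀ t → 3 * (2 * t) ≡ 2 * (3 * t)
        swap = solve-∀

  q K G : ℕ
  q = (r + 1) * r
  K = ⌈2[r+1]/3⌉ r
  G = 2 * q + (n ∸ suc r) * (q ∸ 2 * K)

  ∑pairs-1≡q : ∀ {S} → D S ≡ true → ∑pairs S (λ _ → 1) ≡ q
  ∑pairs-1≡q {S} isBlock = trans (∑pairs-1 S r (D-size isBlock)) (cong (_* r) (+-comm 1 r))

  ∑pairs-edges≤q∸2K : ∀ {S y} → D S ≡ true → lookup S y ≡ false → ∑pairs S (λ Y → 𝟙 (E (Y ∪ ⁅ y ⁆))) ≤ q ∸ 2 * K
  ∑pairs-edges≤q∸2K {S} {y} isBlock Sy = subst (_≤ q ∸ 2 * K) (m+n∸n≡m _ #non-edges)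
    (subst (λ m → m ∸ #non-edges ≤ q ∸ 2 * K) (sym edges+non-edges≡q) (∸-monoʳ-≤ q 2⌈2[r+1]/3⌉≤#non-edges))
    where
    open OutsideVertex isBlock Sy using (#non-edges; 2⌈2[r+1]/3⌉≤#non-edges)
    edges+non-edges≡q : ∑pairs S (λ Y → 𝟙 (E (Y ∪ ⁅ y ⁆))) + #non-edges ≡ q
    edges+non-edges≡q = trans (sym (∑pairs-distrib-+ S (λ Y → 𝟙 (E (Y ∪ ⁅ y ⁆))) (λ Y → 𝟙 (not (E (Y ∪ ⁅ y ⁆))))))
                              (trans (∑pairs-cong S (λ Y → one (E (Y ∪ ⁅ y ⁆)))) (∑pairs-1≡q isBlock))
      where
      one : ∀ b → 𝟙 b + 𝟙 (not b) ≡ 1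
      one true  = refl
      one false = refl

  -- At most two of the vertices completing S - a - b to an edge lie in S.
  deg[S-a-b]≤2+outside : ∀ {S a b} → D S ≡ true → lookup S a ≡ true → lookup (S - a) b ≡ true →
    deg (S - a - b) ≤ 2 + ∑ᵥ (λ y → 𝟙 (not (lookup S y)) * 𝟙 (E ((S - a - b) ∪ ⁅ y ⁆)))
  deg[S-a-b]≤2+outside {S} {a} {b} isBlock Sa Sab = begin
    deg Y
      ≤⟨ ∑ᵥ-mono-≤ pointwise ⟩
    ∑ᵥ (λ v → 𝟙 (lookup S v ∧ not (lookup Y v)) + 𝟙 (not (lookup S v)) * 𝟙 (E (Y ∪ ⁅ v ⁆)))
      ≡⟨ ∑ᵥ-distrib-+ _ _ ⟩
    ∑ᵥ (λ v → 𝟙 (lookup S v ∧ not (lookup Y v))) + ∑ᵥ (λ v → 𝟙 (not (lookup S v)) * 𝟙 (E (Y ∪ ⁅ v ⁆)))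
      ≡⟨ cong (_+ ∑ᵥ (λ v → 𝟙 (not (lookup S v)) * 𝟙 (E (Y ∪ ⁅ v ⁆))))
              (⊆∧∣q∣≡m+∣p∣⇒∣q∖p∣≡m 2 Y⊆S (trans (D-size isBlock) (cong (2 +_) (sym ∣Y∣)))) ⟩
    2 + ∑ᵥ (λ v → 𝟙 (not (lookup S v)) * 𝟙 (E (Y ∪ ⁅ v ⁆))) ∎
    where
    open ≤-Reasoning
    Y : Subset n
    Y = S - a - b
    Y⊆S : Y ⊆ S
    Y⊆S = ⊆-trans (p-x⊆p (S - a) b) (p-x⊆p S a)
    ∣Y∣ : ∣ Y ∣ ≡ suc k
    ∣Y∣ = suc-injective (trans (sym (∣p∣≡1+∣p-x∣ (S - a) b Sab))
                               (suc-injective (trans (sym (∣p∣≡1+∣p-x∣ S a Sa)) (D-size isBlock))))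
    pointwise : ∀ v → 𝟙 (not (lookup Y v)) * 𝟙 (E (Y ∪ ⁅ v ⁆))
                    ≤ 𝟙 (lookup S v ∧ not (lookup Y v)) + 𝟙 (not (lookup S v)) * 𝟙 (E (Y ∪ ⁅ v ⁆))
    pointwise v with lookup S v in Sv
    ... | true  = ≤-trans (*-monoʳ-≤ (𝟙 (not (lookup Y v))) (𝟙≤1 (E (Y ∪ ⁅ v ⁆))))
                          (≤-reflexive (trans (*-identityʳ _) (sym (+-identityʳ _))))
    ... | false rewrite ⊆⇒lookup-false Y⊆S Sv = ≤-refl

  ∑pairs-deg≤G : ∀ {S} → D S ≡ true → ∑pairs S deg ≤ G
  ∑pairs-deg≤G {S} isBlock = begin
    ∑pairs S deg
      ≤⟨ ∑pairs-mono-≤ S {deg} {λ Y → 2 + ∑ᵥ (λ y → outside y Y)} (λ a b Sa Sab → deg[S-a-b]≤2+outside isBlock Sa Sab) ⟩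
    ∑pairs S (λ Y → 2 + ∑ᵥ (λ y → outside y Y))
      ≡⟨ ∑pairs-distrib-+ S (λ _ → 2) (λ Y → ∑ᵥ (λ y → outside y Y)) ⟩
    ∑pairs S (λ _ → 2) + ∑pairs S (λ Y → ∑ᵥ (λ y → outside y Y))
      ≡⟨ cong₂ _+_ (trans (∑pairs-*ˡ S 2 (λ _ → 1)) (cong (2 *_) (∑pairs-1≡q isBlock))) (∑pairs-∑ᵥ S outside) ⟩
    2 * q + ∑ᵥ (λ y → ∑pairs S (outside y))
      ≤⟨ +-monoʳ-≤ (2 * q) (∑ᵥ-mono-≤ perVertex) ⟩
    2 * q + ∑ᵥ (λ y → (q ∸ 2 * K) * 𝟙 (not (lookup S y)))
      ≡⟨ cong (2 * q +_) (trans (∑ᵥ-*ˡ (q ∸ 2 * K) _) (trans (cong ((q ∸ 2 * K) *_) #outside) (*-comm (q ∸ 2 * K) _))) ⟩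
    G ∎
    where
    open ≤-Reasoning
    outside : Fin n → Subset n → ℕ
    outside y Y = 𝟙 (not (lookup S y)) * 𝟙 (E (Y ∪ ⁅ y ⁆))
    #outside : ∑ᵥ (λ y → 𝟙 (not (lookup S y))) ≡ n ∸ suc r
    #outside = trans (∑ᵥ[∉p]≡n∸∣p∣ S) (cong (n ∸_) (D-size isBlock))
    perVertex : ∀ y → ∑pairs S (outside y) ≤ (q ∸ 2 * K) * 𝟙 (not (lookup S y))
    perVertex y rewrite ∑pairs-*ˡ S (𝟙 (not (lookup S y))) (λ Y → 𝟙 (E (Y ∪ ⁅ y ⁆))) with lookup S y in Sy
    ... | true  = z≤n
    ... | false = subst₂ _≤_ (sym (+-identityʳ _)) (sym (*-identityʳ _)) (∑pairs-edges≤q∸2K isBlock Sy)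

  #blocks #faces : ℕ
  #blocks = ∑ₛ (λ S → 𝟙 (D S))
  #faces  = ∑ₛ {n} (λ Y → 𝟙 (∣ Y ∣ ≡ᵇ suc k))

  q²#blocks≤G#faces : q * q * #blocks ≤ G * #faces
  q²#blocks≤G#faces = mean-square-bound (λ Y → 𝟙 (∣ Y ∣ ≡ᵇ suc k)) deg q G #blocks ∑deg≡q#blocks ∑deg²≤G#blocks
    where
    ∑deg≡q#blocks : ∑ₛ (λ Y → 𝟙 (∣ Y ∣ ≡ᵇ suc k) * deg Y) ≡ q * #blocks
    ∑deg≡q#blocks = begin
      ∑ₛ (λ Y → 𝟙 (∣ Y ∣ ≡ᵇ suc k) * deg Y)        ≡⟨ ∑ₛ-cong (λ Y → cong (𝟙 (∣ Y ∣ ≡ᵇ suc k) *_) (sym (*-identityʳ (deg Y)))) ⟩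
      ∑ₛ (λ Y → 𝟙 (∣ Y ∣ ≡ᵇ suc k) * (deg Y * 1))  ≡⟨ ∑deg*w≡∑blocks∑pairs (λ _ → 1) ⟩
      ∑ₛ (λ S → 𝟙 (D S) * ∑pairs S (λ _ → 1))     ≡⟨ ∑ₛ-cong perBlock ⟩
      ∑ₛ (λ S → q * 𝟙 (D S))                      ≡⟨ ∑ₛ-*ˡ q _ ⟩
      q * #blocks                                 ∎
      where
      open ≡-Reasoning
      perBlock : ∀ S → 𝟙 (D S) * ∑pairs S (λ _ → 1) ≡ q * 𝟙 (D S)
      perBlock S with D S in isBlock
      ... | false = sym (*-zeroʳ q)
      ... | true  = trans (+-identityʳ _) (trans (∑pairs-1≡q isBlock) (sym (*-identityʳ q)))
    ∑deg²≤G#blocks : ∑ₛ (λ Y → 𝟙 (∣ Y ∣ ≡ᵇ suc k) * (deg Y * deg Y)) ≤ G * #blocks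
    ∑deg²≤G#blocks = begin
      ∑ₛ (λ Y → 𝟙 (∣ Y ∣ ≡ᵇ suc k) * (deg Y * deg Y)) ≡⟨ ∑deg*w≡∑blocks∑pairs deg ⟩
      ∑ₛ (λ S → 𝟙 (D S) * ∑pairs S deg)              ≤⟨ ∑ₛ-mono-≤ perBlock ⟩
      ∑ₛ (λ S → G * 𝟙 (D S))                         ≡⟨ ∑ₛ-*ˡ G _ ⟩
      G * #blocks                                    ∎
      where
      open ≤-Reasoning
      perBlock : ∀ S → 𝟙 (D S) * ∑pairs S deg ≤ G * 𝟙 (D S)
      perBlock S with D S in isBlock
      ... | false = z≤n
      ... | true  = subst₂ _≤_ (sym (+-identityʳ _)) (sym (*-identityʳ G)) (∑pairs-deg≤G isBlock)

  n≤r⇒#blocks≡0 : n ≤ r → #blocks ≡ 0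
  n≤r⇒#blocks≡0 n≤r = ∑ₛ-zero noBlock
    where
    noBlock : ∀ S → 𝟙 (D S) ≡ 0
    noBlock S with D S in isBlock
    ... | false = refl
    ... | true  = ⊥-elim (<⇒≱ (subst (_≤ n) (D-size isBlock) (∣p∣≤n S)) n≤r)

G*nC[r∸1]≤bound : ∀ r n → 2 ≤ r → r < n →
  (2 * ((r + 1) * r) + (n ∸ suc r) * ((r + 1) * r ∸ 2 * ⌈2[r+1]/3⌉ r)) * (n C (r ∸ 1))
    ≤ 2 * r * (((r + 1) * (3 * r ∸ 4)) / 6) * (n C r) + 4 * ⌈2[r+1]/3⌉ r * (n C (r ∸ 1))
G*nC[r∸1]≤bound (suc zero)      n (s≤s ()) _
G*nC[r∸1]≤bound r@(suc (suc k)) n 2≤r r<n = begin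
  (2 * q + t * Y) * N                ≡⟨ cong (λ m → (2 * m + t * Y) * N) (sym Y+2K≡q) ⟩
  (2 * (Y + 2 * K) + t * Y) * N      ≡⟨ expand Y K t N ⟩
  Y * ((2 + t) * N) + 4 * K * N      ≡⟨ cong (λ m → Y * m + 4 * K * N) (sym r*nCr≡[2+t]*N) ⟩
  Y * (r * (n C r)) + 4 * K * N      ≤⟨ +-monoˡ-≤ (4 * K * N) (*-monoˡ-≤ (r * (n C r)) ([r+1]r∸2K≤2P r)) ⟩
  2 * P * (r * (n C r)) + 4 * K * N  ≡⟨ cong (_+ 4 * K * N) (reorder P r (n C r)) ⟩
  2 * r * P * (n C r) + 4 * K * N    ∎
  where
  open ≤-Reasoning
  q K P Y t N : ℕ
  q = (r + 1) * r
  K = ⌈2[r+1]/3⌉ r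
  P = ((r + 1) * (3 * r ∸ 4)) / 6
  Y = q ∸ 2 * K
  t = n ∸ suc r
  N = n C suc k
  Y+2K≡q : Y + 2 * K ≡ q
  Y+2K≡q = m∸n+n≡m (2⌈2[r+1]/3⌉≤[r+1]r r 2≤r)
  r*nCr≡[2+t]*N : r * (n C r) ≡ (2 + t) * N
  r*nCr≡[2+t]*N = trans ([1+k]*nC[1+k]≡[n∸k]*nCk n (suc k)) (cong (_* N) n∸[1+k]≡2+t)
    where
    n∸[1+k]≡2+t : n ∸ suc k ≡ 2 + t
    n∸[1+k]≡2+t = trans (cong (_∸ suc k) (sym (m+[n∸m]≡n r<n))) (trans (cong (_∸ suc k) (shift k t)) (m+n∸m≡n (suc k) (2 + t)))
      where
      shift : ∀ k t → suc (suc (suc k)) + t ≡ suc k + (2 + t)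
      shift = solve-∀
  expand : ∀ Y K t N → (2 * (Y + 2 * K) + t * Y) * N ≡ Y * ((2 + t) * N) + 4 * K * N
  expand = solve-∀
  reorder : ∀ P r c → 2 * P * (r * c) ≡ 2 * r * P * c
  reorder = solve-∀

theorem10 : ∀ (r n : ℕ) → 3 ≤ r → (H : Hypergraph r n) → IsFriendship H →
    (r * r) * ((r + 1) ^ 2) * numEdges (decompEdge H)
      ≤ 2 * r * (((r + 1) * (3 * r ∸ 4)) / 6) * (n C r)
        + 4 * ((2 * (r + 1) + 2) / 3) * (n C (r ∸ 1))
theorem10 (suc zero)      _ (s≤s ()) _ _
theorem10 r@(suc (suc k)) n 3≤r H friendship = begin
  (r * r) * ((r + 1) ^ 2) * numEdges (decompEdge H)  ≡⟨ cong ((r * r) * ((r + 1) ^ 2) *_) (numEdges≡∑ (decompEdge H)) ⟩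
  (r * r) * ((r + 1) ^ 2) * #blocks                  ≡⟨ square r #blocks ⟩
  q * q * #blocks                                    ≤⟨ bySize (r <? n) ⟩
  bound                                              ∎
  where
  open ≤-Reasoning
  bound : ℕ
  bound = 2 * r * (((r + 1) * (3 * r ∸ 4)) / 6) * (n C r) + 4 * ((2 * (r + 1) + 2) / 3) * (n C (r ∸ 1))
  open FriendshipHypergraph H friendship hiding (r)
  square : ∀ r b → (r * r) * ((r + 1) * ((r + 1) * 1)) * b ≡ (r + 1) * r * ((r + 1) * r) * b
  square = solve-∀
  bySize : Dec (r < n) → q * q * #blocks ≤ bound
  bySize (yes r<n) = ≤-trans q²#blocks≤G#faces
    (subst (λ N → G * N ≤ bound) (sym (∑ₛ-∣∣≡k n (suc k))) (G*nC[r∸1]≤bound r n (≤-trans (n≤1+n 2) 3≤r) r<n))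
  bySize (no  r≮n) = subst (_≤ bound) (sym (trans (cong (q * q *_) (n≤r⇒#blocks≡0 (≮⇒≥ r≮n))) (*-zeroʳ (q * q)))) z≤n
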